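{- Let $n\ge 2$, let $h:[n]\to[n]$ be a Hessenberg function, and let $\lambda=(\lambda_1,\lambda_2)$ be a composition of $n$ with two positive parts. Let $0\le k\le\lambda_2$, and if $\lambda_1>1$ assume additionally that $h(k+2)=n$. Then the function $f^{(k)}_\lambda:S_n\to\mathbb{C}[t_1,\dots,t_n]$ defined by $$f^{(k)}_\lambda(yv)=\begin{cases}\prod_{t_a-t_b\in\mathcal S_k}(t_{y(a)}-t_{y(b)}) & \text{if } v\ge v_k,\\ 0 & \text{otherwise,}\end{cases}\qquad (y\in S_\lambda,\ v\in{}^\lambda S_n)$$ is a well-defined equivariant cohomology class in $H_T^{2|\mathcal S_k|}(\mathrm{Hess}(\mathsf S,h))$, i.e. it satisfies all the GKM divisibility conditions.
   Context: Notation: $[n]=\{1,\dots,n\}$. A Hessenberg function is a nondecreasing map $h:[n]\to[n]$ with $h(i)\ge i$ for all $i$. The group $S_n$ acts on $\mathbb{C}[t_1,\dots,t_n]$ by ring automorphisms with $v(t_i)=t_{v(i)}$; in particular on "roots" $t_i-t_j$. Let $\Phi^+=\{t_i-t_j: i<j\}$, $\Phi^-=\{t_i-t_j:i>j\}$, $\Phi_h^-=\{t_i-t_j: i>j,\ i\le h(j)\}$, $N(w)=\{\gamma\in\Phi^+: w(\gamma)\in\Phi^-\}$, $N^-(w)=\{\gamma\in\Phi^-: w(\gamma)\in\Phi^+\}$, $N_h^-(w)=N^-(w)\cap\Phi_h^-$. For a root $\gamma=t_i-t_j$, $s_\gamma$ is the transposition exchanging $i$ and $j$; $s_i$ is the transposition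 of $i,i+1$. Let $\mathsf S$ be a regular semisimple $n\times n$ complex matrix and $\mathrm{Hess}(\mathsf S,h)=\{V_\bullet\text{ full flags in }\mathbb{C}^n:\ \mathsf S V_i\subseteq V_{h(i)}\ \forall i\}$, with the action of the diagonal torus $T$. Via GKM theory, $H_T^*(\mathrm{Hess}(\mathsf S,h))$ (complex coefficients) is identified with the set of tuples $f=(f(w))_{w\in S_n}$ of polynomials in $\mathbb{C}[t_1,\dots,t_n]$ such that for every $w\in S_n$ and every $\gamma=t_i-t_j\in N_h^-(w)$, the polynomial $t_{w(i)}-t_{w(j)}$ divides $f(w)-f(ws_\gamma)$; $H^{2d}_T$ consists of those tuples whose entries are homogeneous of degree $d$ (or zero). Bruhat order on $S_n$ is denoted $\le$. Two-part compositions: $S_\lambda$ is the subgroup generated by $s_i$, $i\neq\lambda_1$. ${}^\lambda S_n$ is the set of $v\in S_n$ with $v^{ -1}(1)<\dots<v^{ -1}(\lambda_1)$ and $v^{ -1}(\lambda_1+1)<\dots<v^{ -1}(n)$ (minimal-length representatives of right cosets $S_\lambda\backslash S_n$); every $w\in S_n$ is uniquely $w=yv$ with $y\in S_\lambda$, $v\in{}^\lambda S_n$. For $0\le k\le\lambda_2$, $v_k\in S_n$ is the permutation with one-line notation $[\lambda_1+1,\lambda_1+2,\dots,\lambda_1+k,\,1,\,\lambda_1+k+1,\dots,n,\,2,3,\dots,\lambda_1]$ (the entry $1$ in position $k+1$). Set $\mathcal S_k=v_k(N_h^-(v_k))=\{t_a-t_b: a<b,\ v_k^{ -1}(a)>v_k^{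 -1}(b),\ v_k^{ -1}(a)\le h(v_k^{ -1}(b))\}$. -}

module Defs where

open import Level using (0ℓ)
open import Algebra.Bundles using (CommutativeRing)
open import Data.Nat using (ℕ; zero; suc; _+_; _∸_; _≤_; _<_; _<?_; _≤?_; _≟_)
open import Data.Integer using (ℤ; +_; -[1+_])
open import Data.Fin using (Fin; toℕ)
open import Data.Fin.Permutation using (Permutation′; _⟨$⟩ʳ_; _⟨$⟩ˡ_; _∘ₚ_; transpose; id)
open import Data.List using (List; []; _∷_; foldr; concatMap; length; filter; map; allFin)
open import Data.List.Relation.Unary.All using (All)
open import Data.List.Relation.Unary.AllPairs using ()
open import Data.Sum using (_⊎_)
open import Data.Product using (Σ; _×_; _,_)
open import Relation.Binary.PropositionalEquality using (_≡_; _≢_)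
open import Relation.Nullary using (¬_; Dec; yes; no)
open import Relation.Nullary.Decidable using (_×-dec_; ⌊_⌋)

-- Conventions: the paper's [n] = {1,…,n} is encoded as Fin n, where the
-- element a ∈ [n] corresponds to the i : Fin n with toℕ i ≡ a - 1.
-- Permutations are Data.Fin.Permutation.Permutation′ n; w ⟨$⟩ʳ i is w(i).

Perm : ℕ → Set
Perm n = Permutation′ n

-- product in S_n with the usual convention (w · u)(i) = w (u (i))
_·_ : ∀ {n} → Perm n → Perm n → Perm n
w · u = u ∘ₚ w

_≈ₚ_ : ∀ {n} → Perm n → Perm n → Set
_≈ₚ_ {n} u w = (i : Fin n) → u ⟨$⟩ʳ i ≡ w ⟨$⟩ʳ i

-- Polynomials ℤ[t_1,…,t_n] as formal ring expressions; two expressions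
-- are equal as polynomials iff they agree under evaluation in every
-- commutative ring (ℤ[t] is the free commutative ring on the t_i).

infixl 6 _+ₚ_ _-ₚ_
infixl 7 _*ₚ_

data Poly (n : ℕ) : Set where
  var  : Fin n → Poly n
  con  : ℤ → Poly n
  _+ₚ_ : Poly n → Poly n → Poly n
  _*ₚ_ : Poly n → Poly n → Poly n
  -ₚ_  : Poly n → Poly n

_-ₚ_ : ∀ {n} → Poly n → Poly n → Poly n
p -ₚ q = p +ₚ (-ₚ q)

t : ∀ {n} → Fin n → Poly n
t = var

module _ (R : CommutativeRing 0ℓ 0ℓ) where
  open CommutativeRing R using (Carrier; 0#; 1#) renaming (_+_ to _⊕_; _*_ to _⊗_; -_ to ⊖_)

  ℕ→R : ℕ → Carrier
  ℕ→R zero    = 0#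
  ℕ→R (suc m) = 1# ⊕ ℕ→R m

  ℤ→R : ℤ → Carrier
  ℤ→R (+ m)      = ℕ→R m
  ℤ→R -[1+ m ]   = ⊖ ℕ→R (suc m)

  powR : Carrier → ℕ → Carrier
  powR c zero    = 1#
  powR c (suc d) = c ⊗ powR c d

  ⟦_⟧ : ∀ {n} → Poly n → (Fin n → Carrier) → Carrier
  ⟦ var i  ⟧ ρ = ρ i
  ⟦ con z  ⟧ ρ = ℤ→R z
  ⟦ p +ₚ q ⟧ ρ = ⟦ p ⟧ ρ ⊕ ⟦ q ⟧ ρ
  ⟦ p *ₚ q ⟧ ρ = ⟦ p ⟧ ρ ⊗ ⟦ q ⟧ ρ
  ⟦ -ₚ p   ⟧ ρ = ⊖ ⟦ p ⟧ ρ

_≈P_ : ∀ {n} → Poly n → Poly n → Set₁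
_≈P_ {n} p q = (R : CommutativeRing 0ℓ 0ℓ) (ρ : Fin n → CommutativeRing.Carrier R) →
  CommutativeRing._≈_ R (⟦ R ⟧ p ρ) (⟦ R ⟧ q ρ)

_∣P_ : ∀ {n} → Poly n → Poly n → Set₁
d ∣P p = Σ (Poly _) (λ q → p ≈P (d *ₚ q))

Homogeneous : ∀ {n} → ℕ → Poly n → Set₁
Homogeneous {n} d p = (R : CommutativeRing 0ℓ 0ℓ) (ρ : Fin n → CommutativeRing.Carrier R)
  (c : CommutativeRing.Carrier R) →
  CommutativeRing._≈_ R (⟦ R ⟧ p (λ i → CommutativeRing._*_ R c (ρ i)))
                        (CommutativeRing._*_ R (powR R c d) (⟦ R ⟧ p ρ))

IsHessenberg : ∀ {n} → (Fin n → Fin n) → Set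
IsHessenberg {n} h =
  ((i j : Fin n) → toℕ i ≤ toℕ j → toℕ (h i) ≤ toℕ (h j)) ×
  ((i : Fin n) → toℕ i ≤ toℕ (h i))

-- γ = t_i - t_j ∈ N_h^-(w): i > j, i ≤ h(j), and w(γ) = t_{w(i)} - t_{w(j)} ∈ Φ^+
InNh⁻ : ∀ {n} → (Fin n → Fin n) → Perm n → Fin n → Fin n → Set
InNh⁻ h w i j = (toℕ j < toℕ i) × (toℕ i ≤ toℕ (h j)) × (toℕ (w ⟨$⟩ʳ i) < toℕ (w ⟨$⟩ʳ j))

GKM : ∀ {n} → (Fin n → Fin n) → (Perm n → Poly n) → Set₁
GKM {n} h f = (w : Perm n) (i j : Fin n) → InNh⁻ h w i j →
  (t (w ⟨$⟩ʳ i) -ₚ t (w ⟨$⟩ʳ j)) ∣P (f w -ₚ f (w · transpose i j))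

InH2d : ∀ {n} → (Fin n → Fin n) → ℕ → (Perm n → Poly n) → Set₁
InH2d h d f = GKM h f × ((w : Perm _) → Homogeneous d (f w))

allPairs : ∀ {n} → List (Fin n × Fin n)
allPairs {n} = concatMap (λ a → map (λ b → (a , b)) (allFin n)) (allFin n)

inversion? : ∀ {n} (w : Perm n) (p : Fin n × Fin n) → Dec _
inversion? w (a , b) = (toℕ a <? toℕ b) ×-dec (toℕ (w ⟨$⟩ʳ b) <? toℕ (w ⟨$⟩ʳ a))

ℓ : ∀ {n} → Perm n → ℕ
ℓ w = length (filter (inversion? w) allPairs)

data _≤B_ {n : ℕ} (u : Perm n) : Perm n → Set where
  ≤B-refl : ∀ {w} → u ≈ₚ w → u ≤B w
  ≤B-step : ∀ {v w} (i j : Fin n) → u ≤B v → ℓ v < ℓ (v · transpose i j) →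
            w ≈ₚ (v · transpose i j) → u ≤B w

-- s_i (1 ≤ i ≤ n-1) is transpose a b with toℕ a ≡ i - 1, toℕ b ≡ i;
-- a generator of S_λ is such an s_i with i ≢ λ₁.
IsGenλ : ∀ {n} → ℕ → Fin n × Fin n → Set
IsGenλ λ₁ (a , b) = (toℕ b ≡ suc (toℕ a)) × (suc (toℕ a) ≢ λ₁)

wordProd : ∀ {n} → List (Fin n × Fin n) → Perm n
wordProd []            = id
wordProd ((a , b) ∷ ws) = transpose a b · wordProd ws

InSλ : ∀ {n} → ℕ → Perm n → Set
InSλ {n} λ₁ y = Σ (List (Fin n × Fin n)) (λ ws → All (IsGenλ λ₁) ws × (y ≈ₚ wordProd ws))

InλSn : ∀ {n} → ℕ → Perm n → Set
InλSn {n} λ₁ v = (a b : Fin n) → toℕ a < toℕ b →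
  ((toℕ b < λ₁) ⊎ (λ₁ ≤ toℕ a)) → toℕ (v ⟨$⟩ˡ a) < toℕ (v ⟨$⟩ˡ b)

-- one-line notation of v_k (0-indexed): position p ↦ value
--   [λ₁+1, …, λ₁+k, 1, λ₁+k+1, …, n, 2, 3, …, λ₁]
vkFun : ℕ → ℕ → ℕ → ℕ → ℕ
vkFun λ₁ λ₂ k p with p <? k | p ≟ k | p <? suc λ₂
... | yes _ | _     | _     = λ₁ + p
... | no _  | yes _ | _     = 0
... | no _  | no _  | yes _ = λ₁ + p ∸ 1
... | no _  | no _  | no _  = p ∸ λ₂

IsVk : ∀ {n} → ℕ → ℕ → ℕ → Perm n → Set
IsVk {n} λ₁ λ₂ k v = (p : Fin n) → toℕ (v ⟨$⟩ʳ p) ≡ vkFun λ₁ λ₂ k (toℕ p)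

-- t_a - t_b ∈ S_k = v_k(N_h^-(v_k)):
-- a < b, v_k⁻¹(a) > v_k⁻¹(b), v_k⁻¹(a) ≤ h(v_k⁻¹(b))
inSk? : ∀ {n} (h : Fin n → Fin n) (vk : Perm n) (p : Fin n × Fin n) → Dec _
inSk? h vk (a , b) =
  (toℕ a <? toℕ b) ×-dec (toℕ (vk ⟨$⟩ˡ b) <? toℕ (vk ⟨$⟩ˡ a))
    ×-dec (toℕ (vk ⟨$⟩ˡ a) ≤? toℕ (h (vk ⟨$⟩ˡ b)))

Sk : ∀ {n} → (Fin n → Fin n) → Perm n → List (Fin n × Fin n)
Sk h vk = filter (inSk? h vk) allPairs

prodSk : ∀ {n} → (Fin n → Fin n) → Perm n → Perm n → Poly n
prodSk h vk y = foldr (λ { (a , b) acc → (t (y ⟨$⟩ʳ a) -ₚ t (y ⟨$⟩ʳ b)) *ₚ acc })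
                      (con (+ 1)) (Sk h vk)

IsFk : ∀ {n} → ℕ → (Fin n → Fin n) → Perm n → (Perm n → Poly n) → Set₁
IsFk {n} λ₁ h vk f = (w y v : Perm n) → InSλ λ₁ y → InλSn λ₁ v → w ≈ₚ (y · v) →
  (vk ≤B v → f w ≈P prodSk h vk y) × (¬ (vk ≤B v) → f w ≈P con (+ 0))

module Submission where

-- Every w factors uniquely as w = y v with y ∈ S_λ and v ∈ ^λS_n (bubble sort inside the
-- two blocks gives existence; an increasing block-preserving permutation is the identity),
-- so f is well defined and any f with the defining property agrees with it. For v ∈ ^λS_n,
-- v ≥ v_k iff the first k entries of v are large and the entries after position λ₂ + 1 are
-- small: Bruhat ascents only move large values to the left, and conversely such a v is some
-- v_a with k ≤ a ≤ λ₂, reached from v_k by adjacent transpositions. For an edge w — w (i j) with t_i - t_j ∈ N_h^-(w):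
-- if w(i), w(j) lie in the same block, f(w (i j)) is f(w) with t_{w(i)} and t_{w(j)}
-- exchanged, so a divided difference gives the factor. Otherwise w(i) ≤ λ₁ < w(j); if only
-- v is above v_k then (v(i), v(j)) ∈ S_k and t_{w(i)} - t_{w(j)} divides f(w); if both are,
-- f(w) = f(w (i j)) because the two y's differ by a permutation fixing every value ≤ λ₁ + k,
-- and S_k is stable under such permutations, which is where h(k + 2) = n is needed.

open import Defs
open import Level using (0ℓ)
open import Algebra.Bundles using (CommutativeRing)
open import Data.Nat using (ℕ; zero; suc; pred; _+_; _∸_; _≤_; _<_; _<?_; _≤?_; _≟_; z≤n; s≤s; >-nonZero)
open import Data.Nat.Properties
  using (+-cancelʳ-≤; +-cancelˡ-≡; +-comm; +-monoʳ-<; +-monoʳ-≤; +-monoˡ-≤; +-suc; +-∸-assoc;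
         <-asym; <-cmp; <-irrefl; <-trans; <-≤-trans; <⇒≤; <⇒≤pred; <⇒≱; m+[n∸m]≡n; m+n∸m≡n; m<m+n;
         m<n+o⇒m∸n<o; m<n⇒0<n∸m; m≤m+n; m≤n⇒m<n∨m≡n; n<1+n; n≢0⇒n>0; n≤1+n; ∸-monoˡ-<; ≤-<-trans;
         ≤-antisym; ≤-pred; ≤-refl; ≤-reflexive; ≤-trans; ≮⇒≥; ≰⇒>; module ≤-Reasoning)
import Data.Nat.Properties as ℕ
open import Data.Nat.Induction using (<-wellFounded)
open import Induction.WellFounded using (Acc; acc)
open import Data.Integer using (+_)
open import Data.Fin using (Fin; toℕ; fromℕ<)
open import Data.Fin.Properties using (toℕ-injective; toℕ<n; toℕ-fromℕ<; fromℕ<-toℕ; toℕ≤pred[n]; any?; all?)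
import Data.Fin.Properties as Fin
open import Data.Fin.Permutation using (_⟨$⟩ʳ_; _⟨$⟩ˡ_; _∘ₚ_; transpose; flip; inverseˡ; inverseʳ)
open import Data.Fin.Permutation.Components using () renaming (transpose to swap)
open import Data.List using (List; []; _∷_; [_]; foldr; length; filter; map; allFin; _++_; concatMap; cartesianProduct)
open import Data.List.Properties using (length-++; length-map; filter-≐)
open import Data.List.Membership.Propositional using (_∈_)
open import Data.List.Membership.Propositional.Properties
  using (∈-∃++; ∈-++⁻; ∈-++⁺ˡ; ∈-++⁺ʳ; ∈-filter⁺; ∈-filter⁻; ∈-map⁺; ∈-map⁻; ∈-allFin; ∈-cartesianProduct⁺)
open import Data.List.Membership.Propositional.Properties.WithK using (unique∧set⇒bag)
open import Data.List.Relation.Unary.Any using (here; there)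
open import Data.List.Relation.Unary.All using (All; []; _∷_) renaming (lookup to All-lookup)
import Data.List.Relation.Unary.All.Properties as All
open import Data.List.Relation.Unary.AllPairs using ([]; _∷_)
open import Data.List.Relation.Unary.Unique.Propositional using (Unique)
import Data.List.Relation.Unary.Unique.Propositional.Properties as Unique
open import Data.List.Relation.Binary.Permutation.Propositional using (_↭_)
import Data.List.Relation.Binary.Permutation.Propositional as ↭
open import Data.List.Relation.Binary.Permutation.Propositional.Properties using (shift)
open import Data.List.Relation.Binary.BagAndSetEquality using (∼bag⇒↭)
open import Data.Product using (Σ; ∃; _×_; _,_; proj₁; proj₂)
open import Data.Sum using (_⊎_; inj₁; inj₂)
import Data.Sum as Sum
open import Data.Empty using (⊥-elim)
open import Function using (_∘_)
open import Function.Bundles using (mk⇔)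
open import Relation.Binary using (tri<; tri≈; tri>)
open import Relation.Binary.PropositionalEquality
  using (_≡_; _≢_; refl; sym; trans; cong; cong₂; subst; subst₂; module ≡-Reasoning)
open import Relation.Nullary using (¬_; Dec; yes; no; ¬?)
open import Relation.Nullary.Decidable using (_×-dec_; _→-dec_)
open import Relation.Unary using (Pred; Decidable)

private
  variable
    n : ℕ

-- Transpositions and inversions

swap-left : (i j : Fin n) → swap i j i ≡ j
swap-left i j with i Fin.≟ i
... | yes _ = refl
... | no i≢i = ⊥-elim (i≢i refl)

swap-right : (i j : Fin n) → swap i j j ≡ i
swap-right i j with j Fin.≟ i
... | yes j≡i = j≡i
... | no _ with j Fin.≟ j
...   | yes _ = refl
...   | no j≢j = ⊥-elim (j≢j refl)

swap-other : (i j : Fin n) {k : Fin n} → k ≢ i → k ≢ j → swap i j k ≡ k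
swap-other i j {k} k≢i k≢j with k Fin.≟ i
... | yes k≡i = ⊥-elim (k≢i k≡i)
... | no _ with k Fin.≟ j
...   | yes k≡j = ⊥-elim (k≢j k≡j)
...   | no _ = refl

data SwapView (i j k : Fin n) : Set where
  at-left   : k ≡ i → swap i j k ≡ j → SwapView i j k
  at-right  : k ≢ i → k ≡ j → swap i j k ≡ i → SwapView i j k
  elsewhere : k ≢ i → k ≢ j → swap i j k ≡ k → SwapView i j k

swapView : (i j k : Fin n) → SwapView i j k
swapView i j k with k Fin.≟ i | k Fin.≟ j
... | yes refl | _ = at-left refl (swap-left i j)
... | no k≢i | yes refl = at-right k≢i refl (swap-right i j)
... | no k≢i | no k≢j = elsewhere k≢i k≢j (swap-other i j k≢i k≢j)

swap-involutive : (i j k : Fin n) → swap i j (swap i j k) ≡ k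
swap-involutive i j k with swapView i j k
... | at-left refl e = trans (cong (swap i j) e) (swap-right i j)
... | at-right _ refl e = trans (cong (swap i j) e) (swap-left i j)
... | elsewhere _ _ e = trans (cong (swap i j) e) e

swap-comm : (i j k : Fin n) → swap i j k ≡ swap j i k
swap-comm i j k with swapView i j k
... | at-left refl e = trans e (sym (swap-right j k))
... | at-right _ refl e = trans e (sym (swap-left k i))
... | elsewhere k≢i k≢j e = trans e (sym (swap-other j i k≢j k≢i))

swap-self : (i k : Fin n) → swap i i k ≡ k
swap-self i k with swapView i i k
... | at-left k≡i e = trans e (sym k≡i)
... | at-right _ k≡i e = trans e (sym k≡i)
... | elsewhere _ _ e = e

permute-injective : (v : Perm n) {x y : Fin n} → v ⟨$⟩ʳ x ≡ v ⟨$⟩ʳ y → x ≡ y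
permute-injective v e = trans (sym (inverseˡ v)) (trans (cong (v ⟨$⟩ˡ_) e) (inverseˡ v))

toℕ-permute-injective : (v : Perm n) {x y : Fin n} → toℕ (v ⟨$⟩ʳ x) ≡ toℕ (v ⟨$⟩ʳ y) → x ≡ y
toℕ-permute-injective v e = permute-injective v (toℕ-injective e)

swap-conjugate : (u : Perm n) (i j x : Fin n) →
  u ⟨$⟩ʳ swap i j x ≡ swap (u ⟨$⟩ʳ i) (u ⟨$⟩ʳ j) (u ⟨$⟩ʳ x)
swap-conjugate u i j x with swapView i j x
... | at-left refl e = trans (cong (u ⟨$⟩ʳ_) e) (sym (swap-left (u ⟨$⟩ʳ x) (u ⟨$⟩ʳ j)))
... | at-right _ refl e = trans (cong (u ⟨$⟩ʳ_) e) (sym (swap-right (u ⟨$⟩ʳ i) (u ⟨$⟩ʳ x)))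
... | elsewhere x≢i x≢j e = trans (cong (u ⟨$⟩ʳ_) e)
        (sym (swap-other (u ⟨$⟩ʳ i) (u ⟨$⟩ʳ j) (x≢i ∘ permute-injective u) (x≢j ∘ permute-injective u)))

Pair : ℕ → Set
Pair n = Fin n × Fin n

pairMap : (Fin n → Fin n) → Pair n → Pair n
pairMap σ (a , b) = σ a , σ b

Unique⇒length-≤ : ∀ {A : Set} {xs ys : List A} → Unique xs → (∀ {x} → x ∈ xs → x ∈ ys) →
  length xs ≤ length ys
Unique⇒length-≤ {xs = []} _ _ = z≤n
Unique⇒length-≤ {xs = x ∷ xs} (x∉xs ∷ xs!) xs⊆ys with ∈-∃++ (xs⊆ys (here refl))
... | as , bs , refl = begin
  suc (length xs)            ≤⟨ s≤s (Unique⇒length-≤ xs! xs⊆as++bs) ⟩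
  suc (length (as ++ bs))    ≡⟨ cong suc (length-++ as) ⟩
  suc (length as + length bs) ≡⟨ sym (+-suc (length as) (length bs)) ⟩
  length as + suc (length bs) ≡⟨ sym (length-++ as) ⟩
  length (as ++ x ∷ bs)      ∎
  where
  open ≤-Reasoning
  xs⊆as++bs : ∀ {z} → z ∈ xs → z ∈ as ++ bs
  xs⊆as++bs z∈xs with ∈-++⁻ as (xs⊆ys (there z∈xs))
  ... | inj₁ z∈as = ∈-++⁺ˡ z∈as
  ... | inj₂ (here refl) = ⊥-elim (All-lookup x∉xs z∈xs refl)
  ... | inj₂ (there z∈bs) = ∈-++⁺ʳ as z∈bs

allPairs≡cartesianProduct : (xs ys : List (Fin n)) →
  concatMap (λ a → map (a ,_) ys) xs ≡ cartesianProduct xs ys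
allPairs≡cartesianProduct [] ys = refl
allPairs≡cartesianProduct (x ∷ xs) ys = cong (map (x ,_) ys ++_) (allPairs≡cartesianProduct xs ys)

allPairs-unique : Unique (allPairs {n})
allPairs-unique {n} = subst Unique (sym (allPairs≡cartesianProduct (allFin n) (allFin n)))
  (Unique.cartesianProduct⁺ (Unique.allFin⁺ n) (Unique.allFin⁺ n))

∈-allPairs : (p : Pair n) → p ∈ allPairs
∈-allPairs {n} (a , b) = subst ((a , b) ∈_) (sym (allPairs≡cartesianProduct (allFin n) (allFin n)))
  (∈-cartesianProduct⁺ (∈-allFin a) (∈-allFin b))

count : {P : Pred (Pair n) 0ℓ} → Decidable P → ℕ
count P? = length (filter P? allPairs)

module _ {P Q : Pred (Pair n) 0ℓ} (P? : Decidable P) (Q? : Decidable Q) where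

  count-cong : (∀ x → P x → Q x) → (∀ x → Q x → P x) → count P? ≡ count Q?
  count-cong P⇒Q Q⇒P = cong length (filter-≐ P? Q? ((λ {x} → P⇒Q x) , (λ {x} → Q⇒P x)) allPairs)

  count-< : (φ : Pair n → Pair n) → (∀ x y → φ x ≡ φ y → x ≡ y) → (∀ x → P x → Q (φ x)) →
    (x₀ : Pair n) → Q x₀ → (∀ x → P x → φ x ≢ x₀) → count P? < count Q?
  count-< φ φ-inj φ-pres x₀ Qx₀ φ-miss =
    subst (_≤ count Q?) (cong suc (length-map φ Ps)) (Unique⇒length-≤ image-unique image⊆Qs)
    where
    Ps : List (Pair n)
    Ps = filter P? allPairs
    P-of : ∀ {x} → x ∈ Ps → P x
    P-of x∈ = proj₂ (∈-filter⁻ P? {xs = allPairs} x∈)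
    x₀∉image : ∀ xs → (∀ {x} → x ∈ xs → P x) → All (x₀ ≢_) (map φ xs)
    x₀∉image [] _ = []
    x₀∉image (x ∷ xs) P-xs = (λ e → φ-miss x (P-xs (here refl)) (sym e)) ∷ x₀∉image xs (P-xs ∘ there)
    image-unique : Unique (x₀ ∷ map φ Ps)
    image-unique = x₀∉image Ps P-of ∷ Unique.map⁺ (φ-inj _ _) (Unique.filter⁺ P? allPairs-unique)
    image⊆Qs : ∀ {z} → z ∈ x₀ ∷ map φ Ps → z ∈ filter Q? allPairs
    image⊆Qs (here refl) = ∈-filter⁺ Q? (∈-allPairs x₀) Qx₀
    image⊆Qs (there z∈) with ∈-map⁻ φ z∈
    ... | x , x∈ , refl = ∈-filter⁺ Q? (∈-allPairs _) (φ-pres x (P-of x∈))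

Inversion : Perm n → Pair n → Set
Inversion w (a , b) = toℕ a < toℕ b × toℕ (w ⟨$⟩ʳ b) < toℕ (w ⟨$⟩ʳ a)

ℓ-cong : (u w : Perm n) → u ≈ₚ w → ℓ u ≡ ℓ w
ℓ-cong u w u≈w = count-cong (inversion? u) (inversion? w)
  (λ { (a , b) (a<b , inv) → a<b , subst₂ (λ x y → toℕ x < toℕ y) (u≈w b) (u≈w a) inv })
  (λ { (a , b) (a<b , inv) → a<b , subst₂ (λ x y → toℕ x < toℕ y) (sym (u≈w b)) (sym (u≈w a)) inv })

-- The inversions of w = u (i j) inject into those of u other than (i , j): a pair
-- with an end strictly between i and j is kept, any other pair is moved by (i j).
module InversionRemoval (u : Perm n) (i j : Fin n) (i<j : toℕ i < toℕ j)
                        (uj<ui : toℕ (u ⟨$⟩ʳ j) < toℕ (u ⟨$⟩ʳ i)) where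

  w : Perm n
  w = u · transpose i j

  Between : Fin n → Set
  Between p = toℕ i < toℕ p × toℕ p < toℕ j

  between? : (p : Fin n) → Dec (Between p)
  between? p = (toℕ i <? toℕ p) ×-dec (toℕ p <? toℕ j)

  swap-between : ∀ {p} → Between p → swap i j p ≡ p
  swap-between (i<p , p<j) = swap-other i j (λ { refl → <-irrefl refl i<p }) (λ { refl → <-irrefl refl p<j })

  swap-not-between : ∀ p → ¬ Between p → ¬ Between (swap i j p)
  swap-not-between p p∉ with swapView i j p
  ... | at-left _ e = λ { (_ , p<j) → <-irrefl (cong toℕ e) p<j }
  ... | at-right _ _ e = λ { (i<p , _) → <-irrefl (cong toℕ (sym e)) i<p }
  ... | elsewhere _ _ e = subst (λ z → ¬ Between z) (sym e) p∉

  φ′ : {p q : Fin n} → Dec (Between p) → Dec (Between q) → Pair n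
  φ′ {p} {q} (yes _) _ = p , q
  φ′ {p} {q} (no _) (yes _) = p , q
  φ′ {p} {q} (no _) (no _) = swap i j p , swap i j q

  φ : Pair n → Pair n
  φ (p , q) = φ′ (between? p) (between? q)

  φ-involutive : ∀ x → φ (φ x) ≡ x
  φ-involutive (p , q) with between? p | between? q
  ... | yes p∈ | _ with between? p
  ...   | yes _ = refl
  ...   | no p∉ = ⊥-elim (p∉ p∈)
  φ-involutive (p , q) | no p∉ | yes q∈ with between? p | between? q
  ...   | yes p∈ | _ = ⊥-elim (p∉ p∈)
  ...   | no _ | yes _ = refl
  ...   | no _ | no q∉ = ⊥-elim (q∉ q∈)
  φ-involutive (p , q) | no p∉ | no q∉
    with between? (swap i j p) | between? (swap i j q)
  ...   | yes p′∈ | _ = ⊥-elim (swap-not-between p p∉ p′∈)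
  ...   | no _ | yes q′∈ = ⊥-elim (swap-not-between q q∉ q′∈)
  ...   | no _ | no _ = cong₂ _,_ (swap-involutive i j p) (swap-involutive i j q)

  φ-injective : ∀ x y → φ x ≡ φ y → x ≡ y
  φ-injective x y e = trans (sym (φ-involutive x)) (trans (cong φ e) (φ-involutive y))

  U : Fin n → ℕ
  U p = toℕ (u ⟨$⟩ʳ p)

  inversion-first-between : ∀ {p q} → Between p → toℕ p < toℕ q → U (swap i j q) < U p → U q < U p
  inversion-first-between {p} {q} p∈ p<q inv with swapView i j q
  ... | at-left refl _ = ⊥-elim (<-asym p<q (proj₁ p∈))
  ... | at-right _ refl e = <-trans uj<ui (subst (λ z → U z < U p) e inv)
  ... | elsewhere _ _ e = subst (λ z → U z < U p) e inv

  inversion-second-between : ∀ {p q} → Between q → toℕ p < toℕ q → U q < U (swap i j p) → U q < U p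
  inversion-second-between {p} {q} q∈ p<q inv with swapView i j p
  ... | at-left refl e = <-trans (subst (λ z → U q < U z) e inv) uj<ui
  ... | at-right _ refl _ = ⊥-elim (<-asym p<q (proj₂ q∈))
  ... | elsewhere _ _ e = subst (λ z → U q < U z) e inv

  outside-order : ∀ {p q} → ¬ Between p → ¬ Between q → toℕ p < toℕ q →
    U (swap i j q) < U (swap i j p) → toℕ (swap i j p) < toℕ (swap i j q)
  outside-order {p} {q} p∉ q∉ p<q inv with swapView i j p | swapView i j q
  ... | at-left refl _ | at-left refl _ = ⊥-elim (<-irrefl refl p<q)
  ... | at-left refl e | at-right _ refl e′ =
          ⊥-elim (<-asym uj<ui (subst₂ (λ a b → U a < U b) e′ e inv))
  ... | at-left refl e | elsewhere _ q≢j e′ = subst₂ (λ a b → toℕ a < toℕ b) (sym e) (sym e′) j<q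
    where
    j<q : toℕ j < toℕ q
    j<q with <-cmp (toℕ j) (toℕ q)
    ... | tri< j<q _ _ = j<q
    ... | tri≈ _ j≡q _ = ⊥-elim (q≢j (toℕ-injective (sym j≡q)))
    ... | tri> _ _ q<j = ⊥-elim (q∉ (p<q , q<j))
  ... | at-right _ refl _ | at-left refl _ = ⊥-elim (<-asym p<q i<j)
  ... | at-right _ refl _ | at-right _ refl _ = ⊥-elim (<-irrefl refl p<q)
  ... | at-right _ refl e | elsewhere _ _ e′ =
          subst₂ (λ a b → toℕ a < toℕ b) (sym e) (sym e′) (<-trans i<j p<q)
  ... | elsewhere _ _ e | at-left refl e′ =
          subst₂ (λ a b → toℕ a < toℕ b) (sym e) (sym e′) (<-trans p<q i<j)
  ... | elsewhere p≢i _ e | at-right _ refl e′ = subst₂ (λ a b → toℕ a < toℕ b) (sym e) (sym e′) p<i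
    where
    p<i : toℕ p < toℕ i
    p<i with <-cmp (toℕ p) (toℕ i)
    ... | tri< p<i _ _ = p<i
    ... | tri≈ _ p≡i _ = ⊥-elim (p≢i (toℕ-injective p≡i))
    ... | tri> _ _ i<p = ⊥-elim (p∉ (i<p , p<q))
  ... | elsewhere _ _ e | elsewhere _ _ e′ = subst₂ (λ a b → toℕ a < toℕ b) (sym e) (sym e′) p<q

  φ-preserves : ∀ x → Inversion w x → Inversion u (φ x)
  φ-preserves (p , q) (p<q , inv) with between? p | between? q
  ... | yes p∈ | _ =
          p<q , inversion-first-between p∈ p<q (subst (λ z → U (swap i j q) < U z) (swap-between p∈) inv)
  ... | no _ | yes q∈ =
          p<q , inversion-second-between q∈ p<q (subst (λ z → U z < U (swap i j p)) (swap-between q∈) inv)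
  ... | no p∉ | no q∉ = outside-order p∉ q∉ p<q inv , inv

  φ-misses : ∀ x → Inversion w x → φ x ≢ (i , j)
  φ-misses (p , q) (p<q , _) e with between? p | between? q
  ... | yes p∈ | _ = <-irrefl (cong (toℕ ∘ proj₁) (sym e)) (proj₁ p∈)
  ... | no _ | yes q∈ = <-irrefl (cong (toℕ ∘ proj₂) e) (proj₂ q∈)
  ... | no _ | no _ = <-asym i<j (subst₂ (λ a b → toℕ a < toℕ b) p≡j q≡i p<q)
    where
    p≡j : p ≡ j
    p≡j = trans (sym (swap-involutive i j p)) (trans (cong (swap i j ∘ proj₁) e) (swap-left i j))
    q≡i : q ≡ i
    q≡i = trans (sym (swap-involutive i j q)) (trans (cong (swap i j ∘ proj₂) e) (swap-right i j))

ℓ-swap-inversion : (u : Perm n) (i j : Fin n) → toℕ i < toℕ j → toℕ (u ⟨$⟩ʳ j) < toℕ (u ⟨$⟩ʳ i) →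
  ℓ (u · transpose i j) < ℓ u
ℓ-swap-inversion u i j i<j uj<ui =
  count-< (inversion? w) (inversion? u) φ φ-injective φ-preserves (i , j) (i<j , uj<ui) φ-misses
  where open InversionRemoval u i j i<j uj<ui

≤B-respʳ : {u v w : Perm n} → u ≤B v → v ≈ₚ w → u ≤B w
≤B-respʳ (≤B-refl u≈v) v≈w = ≤B-refl (λ x → trans (u≈v x) (v≈w x))
≤B-respʳ (≤B-step i j u≤v′ ℓ< v≈) v≈w = ≤B-step i j u≤v′ ℓ< (λ x → trans (sym (v≈w x)) (v≈ x))

ℓ-<⇒ascent : (v : Perm n) (i j : Fin n) → toℕ i < toℕ j → ℓ v < ℓ (v · transpose i j) →
  toℕ (v ⟨$⟩ʳ i) < toℕ (v ⟨$⟩ʳ j)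
ℓ-<⇒ascent v i j i<j ℓ< with <-cmp (toℕ (v ⟨$⟩ʳ i)) (toℕ (v ⟨$⟩ʳ j))
... | tri< vi<vj _ _ = vi<vj
... | tri≈ _ vi≡vj _ = ⊥-elim (<-irrefl (cong toℕ (toℕ-permute-injective v vi≡vj)) i<j)
... | tri> _ _ vj<vi = ⊥-elim (<-asym ℓ< (ℓ-swap-inversion v i j i<j vj<vi))

ℓ-swap-self : (v : Perm n) (i : Fin n) → ℓ (v · transpose i i) ≡ ℓ v
ℓ-swap-self v i = ℓ-cong (v · transpose i i) v (λ x → cong (v ⟨$⟩ʳ_) (swap-self i x))

ℓ-swap-comm : (v : Perm n) (i j : Fin n) → ℓ (v · transpose i j) ≡ ℓ (v · transpose j i)
ℓ-swap-comm v i j = ℓ-cong (v · transpose i j) (v · transpose j i) (λ x → cong (v ⟨$⟩ʳ_) (swap-comm i j x))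

ascent-of-ℓ-< : (v : Perm n) (i j : Fin n) → ℓ v < ℓ (v · transpose i j) →
  Σ (Fin n) λ a → Σ (Fin n) λ b → toℕ a < toℕ b × toℕ (v ⟨$⟩ʳ a) < toℕ (v ⟨$⟩ʳ b) ×
    (∀ x → swap i j x ≡ swap a b x)
ascent-of-ℓ-< v i j ℓ< with <-cmp (toℕ i) (toℕ j)
... | tri< i<j _ _ = i , j , i<j , ℓ-<⇒ascent v i j i<j ℓ< , λ _ → refl
... | tri> _ _ j<i = j , i , j<i , ℓ-<⇒ascent v j i j<i (subst (ℓ v <_) (ℓ-swap-comm v i j) ℓ<) , swap-comm i j
... | tri≈ _ i≡j _ with toℕ-injective i≡j
...   | refl = ⊥-elim (<-irrefl (sym (ℓ-swap-self v i)) ℓ<)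

-- Increasing maps on intervals; the one-line notation of v_k

StrictlyIncreasingOn : ℕ → ℕ → (ℕ → ℕ) → Set
StrictlyIncreasingOn lo hi g = ∀ s t → lo ≤ s → s < t → t < hi → g s < g t

module _ {g : ℕ → ℕ} {lo hi : ℕ} (g-inc : StrictlyIncreasingOn lo hi g) where

  increasing-+-≤ : ∀ s d → lo ≤ s → s + d < hi → g s + d ≤ g (s + d)
  increasing-+-≤ s zero lo≤s _ = ≤-reflexive (trans (ℕ.+-identityʳ (g s)) (cong g (sym (ℕ.+-identityʳ s))))
  increasing-+-≤ s (suc d) lo≤s s+d<hi = begin
    g s + suc d     ≡⟨ +-suc (g s) d ⟩
    suc (g s + d)   ≤⟨ s≤s (increasing-+-≤ s d lo≤s (<-trans (+-monoʳ-< s (n<1+n d)) s+d<hi)) ⟩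
    suc (g (s + d)) ≤⟨ g-inc (s + d) (s + suc d) (≤-trans lo≤s (m≤m+n s d)) (+-monoʳ-< s (n<1+n d)) s+d<hi ⟩
    g (s + suc d)   ∎
    where open ≤-Reasoning

  increasing-endo⇒id : (∀ s → lo ≤ s → s < hi → lo ≤ g s × g s < hi) → ∀ s → lo ≤ s → s < hi → g s ≡ s
  increasing-endo⇒id g-into s lo≤s s<hi = ≤-antisym g-s≤s s≤g-s
    where
    open ≤-Reasoning
    s≤g-s : s ≤ g s
    s≤g-s = begin
      s                ≡⟨ sym (m+[n∸m]≡n lo≤s) ⟩
      lo + (s ∸ lo)    ≤⟨ +-monoˡ-≤ (s ∸ lo) (proj₁ (g-into lo ≤-refl (≤-<-trans lo≤s s<hi))) ⟩
      g lo + (s ∸ lo)  ≤⟨ increasing-+-≤ lo (s ∸ lo) ≤-refl (subst (_< hi) (sym (m+[n∸m]≡n lo≤s)) s<hi) ⟩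
      g (lo + (s ∸ lo)) ≡⟨ cong g (m+[n∸m]≡n lo≤s) ⟩
      g s              ∎
    d = hi ∸ suc s
    s+d≡hi-1 : s + d ≡ hi ∸ 1
    s+d≡hi-1 = cong pred (m+[n∸m]≡n s<hi)
    s+d<hi : s + d < hi
    s+d<hi = subst (s + d <_) (m+[n∸m]≡n s<hi) (n<1+n (s + d))
    g-s≤s : g s ≤ s
    g-s≤s = +-cancelʳ-≤ d (g s) s (begin
      g s + d   ≤⟨ increasing-+-≤ s d lo≤s s+d<hi ⟩
      g (s + d) ≤⟨ <⇒≤pred (proj₂ (g-into (s + d) (≤-trans lo≤s (m≤m+n s d)) s+d<hi)) ⟩
      hi ∸ 1    ≡⟨ sym s+d≡hi-1 ⟩
      s + d     ∎)

adjacent-increasing⇒increasing : {g : ℕ → ℕ} {lo hi : ℕ} →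
  (∀ r → lo ≤ r → suc r < hi → g r < g (suc r)) → StrictlyIncreasingOn lo hi g
adjacent-increasing⇒increasing g-adj s (suc t) lo≤s s<1+t 1+t<hi with m≤n⇒m<n∨m≡n (≤-pred s<1+t)
... | inj₂ refl = g-adj s lo≤s 1+t<hi
... | inj₁ s<t = <-trans (adjacent-increasing⇒increasing g-adj s t lo≤s s<t (<-trans (n<1+n t) 1+t<hi))
                         (g-adj t (≤-trans lo≤s (<⇒≤ s<t)) 1+t<hi)

-- junk value 0 outside [0, n)
onℕ : (Fin n → Fin n) → ℕ → ℕ
onℕ {n} f s with s <? n
... | yes s<n = toℕ (f (fromℕ< s<n))
... | no _ = 0

onℕ-toℕ : (f : Fin n → Fin n) (x : Fin n) → onℕ f (toℕ x) ≡ toℕ (f x)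
onℕ-toℕ {n} f x with toℕ x <? n
... | yes x<n = cong (toℕ ∘ f) (fromℕ<-toℕ x x<n)
... | no x≮n = ⊥-elim (x≮n (toℕ<n x))

onℕ-fromℕ< : (f : Fin n → Fin n) {s : ℕ} (s<n : s < n) → onℕ f s ≡ toℕ (f (fromℕ< s<n))
onℕ-fromℕ< f s<n = trans (cong (onℕ f) (sym (toℕ-fromℕ< s<n))) (onℕ-toℕ f (fromℕ< s<n))

onℕ-< : (f : Fin n → Fin n) {s : ℕ} → s < n → onℕ f s < n
onℕ-< f s<n = subst (_< _) (sym (onℕ-fromℕ< f s<n)) (toℕ<n _)

module PermOnℕ {n : ℕ} (v : Perm n) where

  V : ℕ → ℕ
  V = onℕ (v ⟨$⟩ʳ_)

  V⁻¹ : ℕ → ℕ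
  V⁻¹ = onℕ (v ⟨$⟩ˡ_)

  V⁻¹-V : ∀ {p} → p < n → V⁻¹ (V p) ≡ p
  V⁻¹-V {p} p<n = begin
    V⁻¹ (V p)                          ≡⟨ cong V⁻¹ (onℕ-fromℕ< _ p<n) ⟩
    V⁻¹ (toℕ (v ⟨$⟩ʳ fromℕ< p<n))       ≡⟨ onℕ-toℕ _ _ ⟩
    toℕ (v ⟨$⟩ˡ (v ⟨$⟩ʳ fromℕ< p<n))    ≡⟨ cong toℕ (inverseˡ v) ⟩
    toℕ (fromℕ< p<n)                   ≡⟨ toℕ-fromℕ< p<n ⟩
    p                                  ∎
    where open ≡-Reasoning

  V-V⁻¹ : ∀ {p} → p < n → V (V⁻¹ p) ≡ p
  V-V⁻¹ {p} p<n = begin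
    V (V⁻¹ p)                          ≡⟨ cong V (onℕ-fromℕ< _ p<n) ⟩
    V (toℕ (v ⟨$⟩ˡ fromℕ< p<n))         ≡⟨ onℕ-toℕ _ _ ⟩
    toℕ (v ⟨$⟩ʳ (v ⟨$⟩ˡ fromℕ< p<n))    ≡⟨ cong toℕ (inverseʳ v) ⟩
    toℕ (fromℕ< p<n)                   ≡⟨ toℕ-fromℕ< p<n ⟩
    p                                  ∎
    where open ≡-Reasoning

  V-injective : ∀ {p q} → p < n → q < n → V p ≡ V q → p ≡ q
  V-injective p<n q<n e = trans (sym (V⁻¹-V p<n)) (trans (cong V⁻¹ e) (V⁻¹-V q<n))

vkFun-before : ∀ λ₁ λ₂ k {p} → p < k → vkFun λ₁ λ₂ k p ≡ λ₁ + p
vkFun-before λ₁ λ₂ k {p} p<k with p <? k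
... | yes _ = refl
... | no p≮k = ⊥-elim (p≮k p<k)

vkFun-at : ∀ λ₁ λ₂ k → vkFun λ₁ λ₂ k k ≡ 0
vkFun-at λ₁ λ₂ k with k <? k | k ≟ k
... | yes k<k | _ = ⊥-elim (<-irrefl refl k<k)
... | no _ | yes _ = refl
... | no _ | no k≢k = ⊥-elim (k≢k refl)

vkFun-middle : ∀ λ₁ λ₂ k {p} → k < p → p ≤ λ₂ → vkFun λ₁ λ₂ k p ≡ λ₁ + p ∸ 1
vkFun-middle λ₁ λ₂ k {p} k<p p≤λ₂ with p <? k | p ≟ k | p <? suc λ₂
... | yes p<k | _ | _ = ⊥-elim (<-asym p<k k<p)
... | no _ | yes refl | _ = ⊥-elim (<-irrefl refl k<p)
... | no _ | no _ | yes _ = refl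
... | no _ | no _ | no p≰λ₂ = ⊥-elim (p≰λ₂ (s≤s p≤λ₂))

vkFun-after : ∀ λ₁ λ₂ k {p} → k ≤ λ₂ → λ₂ < p → vkFun λ₁ λ₂ k p ≡ p ∸ λ₂
vkFun-after λ₁ λ₂ k {p} k≤λ₂ λ₂<p with p <? k | p ≟ k | p <? suc λ₂
... | yes p<k | _ | _ = ⊥-elim (<-asym λ₂<p (<-≤-trans p<k k≤λ₂))
... | no _ | yes refl | _ = ⊥-elim (<-irrefl refl (≤-<-trans k≤λ₂ λ₂<p))
... | no _ | no _ | yes p≤λ₂ = ⊥-elim (<-irrefl refl (≤-<-trans (≤-pred p≤λ₂) λ₂<p))
... | no _ | no _ | no _ = refl

data VkFunView (λ₁ λ₂ m p : ℕ) : Set where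
  before : p < m → vkFun λ₁ λ₂ m p ≡ λ₁ + p → VkFunView λ₁ λ₂ m p
  at     : p ≡ m → vkFun λ₁ λ₂ m p ≡ 0 → VkFunView λ₁ λ₂ m p
  middle : m < p → p ≤ λ₂ → vkFun λ₁ λ₂ m p ≡ λ₁ + p ∸ 1 → VkFunView λ₁ λ₂ m p
  after  : λ₂ < p → vkFun λ₁ λ₂ m p ≡ p ∸ λ₂ → VkFunView λ₁ λ₂ m p

vkFunView : ∀ λ₁ λ₂ m p → m ≤ λ₂ → VkFunView λ₁ λ₂ m p
vkFunView λ₁ λ₂ m p m≤λ₂ with <-cmp p m
... | tri< p<m _ _ = before p<m (vkFun-before λ₁ λ₂ m p<m)
... | tri≈ _ refl _ = at refl (vkFun-at λ₁ λ₂ m)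
... | tri> _ _ m<p with p ≤? λ₂
...   | yes p≤λ₂ = middle m<p p≤λ₂ (vkFun-middle λ₁ λ₂ m m<p p≤λ₂)
...   | no p≰λ₂ = after (≰⇒> p≰λ₂) (vkFun-after λ₁ λ₂ m m≤λ₂ (≰⇒> p≰λ₂))

vkFun-after-< : ∀ {λ₁ λ₂ p} → 1 ≤ λ₁ → p < λ₁ + λ₂ → p ∸ λ₂ < λ₁
vkFun-after-< {λ₁} {λ₂} {p} 1≤λ₁ p<λ₁+λ₂ = m<n+o⇒m∸n<o p λ₂ {{>-nonZero 1≤λ₁}} (subst (p <_) (+-comm λ₁ λ₂) p<λ₁+λ₂)

vkFun-small⇒at : ∀ λ₁ λ₂ a {x} → a ≤ λ₂ → x ≤ λ₂ → vkFun λ₁ λ₂ a x < λ₁ → x ≡ a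
vkFun-small⇒at λ₁ λ₂ a {x} a≤λ₂ x≤λ₂ small with vkFunView λ₁ λ₂ a x a≤λ₂
... | before _ e = ⊥-elim (<⇒≱ (subst (_< λ₁) e small) (m≤m+n λ₁ x))
... | at x≡a _ = x≡a
... | middle a<x _ e = ⊥-elim (<⇒≱ (subst (_< λ₁) e small) (≤-trans (m≤m+n λ₁ (x ∸ 1)) (≤-reflexive (sym (+-∸-assoc λ₁ (≤-trans (s≤s z≤n) a<x))))))
... | after λ₂<x _ = ⊥-elim (<-irrefl refl (<-≤-trans λ₂<x x≤λ₂))

-- Bruhat order above v_k

-- For v ∈ ^λS_n this is v ≥ v_k in Bruhat order: the first k entries of v exceed λ₁
-- and the entries after position λ₂ + 1 are at most λ₁.
AboveVk : ℕ → ℕ → ℕ → (Fin n → Fin n) → Set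
AboveVk λ₁ λ₂ k u = (∀ x → toℕ x < k → λ₁ ≤ toℕ (u x)) × (∀ x → λ₂ < toℕ x → toℕ (u x) < λ₁)

module _ {λ₁ λ₂ k : ℕ} where

  AboveVk-resp : {u w : Fin n → Fin n} → (∀ x → u x ≡ w x) → AboveVk λ₁ λ₂ k u → AboveVk λ₁ λ₂ k w
  AboveVk-resp u≗w (big , small) =
    (λ x x<k → subst (λ z → λ₁ ≤ toℕ z) (u≗w x) (big x x<k)) ,
    (λ x λ₂<x → subst (λ z → toℕ z < λ₁) (u≗w x) (small x λ₂<x))

  AboveVk-ascent : (v : Fin n → Fin n) (a b : Fin n) → toℕ a < toℕ b → toℕ (v a) < toℕ (v b) →
    AboveVk λ₁ λ₂ k v → AboveVk λ₁ λ₂ k (v ∘ swap a b)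
  AboveVk-ascent v a b a<b va<vb (big , small) = big′ , small′
    where
    big′ : ∀ x → toℕ x < k → λ₁ ≤ toℕ (v (swap a b x))
    big′ x x<k with swapView a b x
    ... | at-left refl e = subst (λ z → λ₁ ≤ toℕ (v z)) (sym e) (<⇒≤ (≤-<-trans (big a x<k) va<vb))
    ... | at-right _ refl e = subst (λ z → λ₁ ≤ toℕ (v z)) (sym e) (big a (<-trans a<b x<k))
    ... | elsewhere _ _ e = subst (λ z → λ₁ ≤ toℕ (v z)) (sym e) (big x x<k)
    small′ : ∀ x → λ₂ < toℕ x → toℕ (v (swap a b x)) < λ₁
    small′ x λ₂<x with swapView a b x
    ... | at-left refl e = subst (λ z → toℕ (v z) < λ₁) (sym e) (small b (<-trans λ₂<x a<b))
    ... | at-right _ refl e = subst (λ z → toℕ (v z) < λ₁) (sym e) (<-trans va<vb (small b λ₂<x))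
    ... | elsewhere _ _ e = subst (λ z → toℕ (v z) < λ₁) (sym e) (small x λ₂<x)

  ≤B-AboveVk : {u v : Perm n} → u ≤B v → AboveVk λ₁ λ₂ k (u ⟨$⟩ʳ_) → AboveVk λ₁ λ₂ k (v ⟨$⟩ʳ_)
  ≤B-AboveVk (≤B-refl u≈v) above = AboveVk-resp u≈v above
  ≤B-AboveVk (≤B-step {v′} i j u≤v′ ℓ< v≈) above with ascent-of-ℓ-< v′ i j ℓ<
  ... | a , b , a<b , ascent , swap≗ =
    AboveVk-resp (λ x → trans (cong (v′ ⟨$⟩ʳ_) (sym (swap≗ x))) (sym (v≈ x)))
                 (AboveVk-ascent (v′ ⟨$⟩ʳ_) a b a<b ascent (≤B-AboveVk u≤v′ above))

vkFun-step-other : ∀ λ₁ λ₂ m {p} → suc m ≤ λ₂ → p ≢ m → p ≢ suc m →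
  vkFun λ₁ λ₂ m p ≡ vkFun λ₁ λ₂ (suc m) p
vkFun-step-other λ₁ λ₂ m {p} m<λ₂ p≢m p≢1+m with vkFunView λ₁ λ₂ m p (<⇒≤ m<λ₂)
... | before p<m e = trans e (sym (vkFun-before λ₁ λ₂ (suc m) (<-trans p<m (n<1+n m))))
... | at p≡m _ = ⊥-elim (p≢m p≡m)
... | middle m<p p≤λ₂ e with m≤n⇒m<n∨m≡n m<p
...   | inj₁ 1+m<p = trans e (sym (vkFun-middle λ₁ λ₂ (suc m) 1+m<p p≤λ₂))
...   | inj₂ 1+m≡p = ⊥-elim (p≢1+m (sym 1+m≡p))
vkFun-step-other λ₁ λ₂ m m<λ₂ _ _ | after λ₂<p e = trans e (sym (vkFun-after λ₁ λ₂ (suc m) m<λ₂ λ₂<p))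

module VkChain {n : ℕ} (λ₁ λ₂ : ℕ) (1≤λ₁ : 1 ≤ λ₁) (λ-sum : λ₁ + λ₂ ≡ n) where

  ≤λ₂⇒<n : ∀ {m} → m ≤ λ₂ → m < n
  ≤λ₂⇒<n {m} m≤λ₂ = subst (m <_) λ-sum (≤-trans (s≤s m≤λ₂) (+-monoˡ-≤ λ₂ 1≤λ₁))

  -- v_{m+1} = v_m (m+1 m+2), a length-increasing step
  module Step (m : ℕ) (m<λ₂ : m < λ₂) (u : Perm n) (u-isVk : IsVk λ₁ λ₂ m u) where

    a b : Fin n
    a = fromℕ< (≤λ₂⇒<n (<⇒≤ m<λ₂))
    b = fromℕ< (≤λ₂⇒<n m<λ₂)

    toℕ-a : toℕ a ≡ m
    toℕ-a = toℕ-fromℕ< (≤λ₂⇒<n (<⇒≤ m<λ₂))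

    toℕ-b : toℕ b ≡ suc m
    toℕ-b = toℕ-fromℕ< (≤λ₂⇒<n m<λ₂)

    u′ : Perm n
    u′ = u · transpose a b

    u′-isVk : IsVk λ₁ λ₂ (suc m) u′
    u′-isVk p with swapView a b p
    ... | at-left refl e = begin
      toℕ (u ⟨$⟩ʳ swap a b a)        ≡⟨ cong (λ z → toℕ (u ⟨$⟩ʳ z)) e ⟩
      toℕ (u ⟨$⟩ʳ b)                 ≡⟨ u-isVk b ⟩
      vkFun λ₁ λ₂ m (toℕ b)          ≡⟨ cong (vkFun λ₁ λ₂ m) toℕ-b ⟩
      vkFun λ₁ λ₂ m (suc m)          ≡⟨ vkFun-middle λ₁ λ₂ m (n<1+n m) m<λ₂ ⟩
      λ₁ + suc m ∸ 1                 ≡⟨ cong (_∸ 1) (+-suc λ₁ m) ⟩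
      λ₁ + m                         ≡⟨ sym (vkFun-before λ₁ λ₂ (suc m) (n<1+n m)) ⟩
      vkFun λ₁ λ₂ (suc m) m          ≡⟨ cong (vkFun λ₁ λ₂ (suc m)) (sym toℕ-a) ⟩
      vkFun λ₁ λ₂ (suc m) (toℕ a)    ∎
      where open ≡-Reasoning
    ... | at-right _ refl e = begin
      toℕ (u ⟨$⟩ʳ swap a b b)        ≡⟨ cong (λ z → toℕ (u ⟨$⟩ʳ z)) e ⟩
      toℕ (u ⟨$⟩ʳ a)                 ≡⟨ u-isVk a ⟩
      vkFun λ₁ λ₂ m (toℕ a)          ≡⟨ cong (vkFun λ₁ λ₂ m) toℕ-a ⟩
      vkFun λ₁ λ₂ m m                ≡⟨ vkFun-at λ₁ λ₂ m ⟩
      0                              ≡⟨ sym (vkFun-at λ₁ λ₂ (suc m)) ⟩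
      vkFun λ₁ λ₂ (suc m) (suc m)    ≡⟨ cong (vkFun λ₁ λ₂ (suc m)) (sym toℕ-b) ⟩
      vkFun λ₁ λ₂ (suc m) (toℕ b)    ∎
      where open ≡-Reasoning
    ... | elsewhere p≢a p≢b e = trans (cong (λ z → toℕ (u ⟨$⟩ʳ z)) e) (trans (u-isVk p)
            (vkFun-step-other λ₁ λ₂ m m<λ₂ (λ p≡m → p≢a (toℕ-injective (trans p≡m (sym toℕ-a))))
                                         (λ p≡1+m → p≢b (toℕ-injective (trans p≡1+m (sym toℕ-b))))))

    ℓ-< : ℓ u < ℓ u′
    ℓ-< = subst (_< ℓ u′) (ℓ-cong (u′ · transpose a b) u (λ x → cong (u ⟨$⟩ʳ_) (swap-involutive a b x)))
            (ℓ-swap-inversion u′ a b (subst₂ _<_ (sym toℕ-a) (sym toℕ-b) (n<1+n m)) u′b<u′a)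
      where
      u′b<u′a : toℕ (u′ ⟨$⟩ʳ b) < toℕ (u′ ⟨$⟩ʳ a)
      u′b<u′a = subst₂ _<_
        (sym (trans (u′-isVk b) (trans (cong (vkFun λ₁ λ₂ (suc m)) toℕ-b) (vkFun-at λ₁ λ₂ (suc m)))))
        (sym (trans (u′-isVk a) (trans (cong (vkFun λ₁ λ₂ (suc m)) toℕ-a) (vkFun-before λ₁ λ₂ (suc m) (n<1+n m)))))
        (≤-trans 1≤λ₁ (m≤m+n λ₁ m))

  chain : ∀ {k} {vk : Perm n} → IsVk λ₁ λ₂ k vk →
    ∀ d → k + d ≤ λ₂ → Σ (Perm n) λ u → IsVk λ₁ λ₂ (k + d) u × vk ≤B u
  chain {k} {vk} vk-isVk zero _ =
    vk , (λ p → subst (λ m → toℕ (vk ⟨$⟩ʳ p) ≡ vkFun λ₁ λ₂ m (toℕ p)) (sym (ℕ.+-identityʳ k)) (vk-isVk p)) ,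
    ≤B-refl (λ _ → refl)
  chain {k} vk-isVk (suc d) k+1+d≤λ₂ with chain vk-isVk d (≤-trans (+-monoʳ-≤ k (n≤1+n d)) k+1+d≤λ₂)
  ... | u , u-isVk , vk≤u = u′ , u′-isVk′ , ≤B-step a b vk≤u ℓ-< (λ _ → refl)
    where
    open Step (k + d) (subst (_≤ λ₂) (+-suc k d) k+1+d≤λ₂) u u-isVk
    u′-isVk′ : IsVk λ₁ λ₂ (k + suc d) u′
    u′-isVk′ p = trans (u′-isVk p) (cong (λ m → vkFun λ₁ λ₂ m (toℕ p)) (sym (+-suc k d)))

  IsVk-≤B : ∀ {k a} {vk v : Perm n} → IsVk λ₁ λ₂ k vk → k ≤ a → a ≤ λ₂ → IsVk λ₁ λ₂ a v → vk ≤B v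
  IsVk-≤B {k} {a} {v = v} vk-isVk k≤a a≤λ₂ v-isVk
    with chain vk-isVk (a ∸ k) (subst (_≤ λ₂) (sym (m+[n∸m]≡n k≤a)) a≤λ₂)
  ... | u , u-isVk , vk≤u = ≤B-respʳ vk≤u λ p → toℕ-injective (begin
    toℕ (u ⟨$⟩ʳ p)                 ≡⟨ u-isVk p ⟩
    vkFun λ₁ λ₂ (k + (a ∸ k)) (toℕ p) ≡⟨ cong (λ m → vkFun λ₁ λ₂ m (toℕ p)) (m+[n∸m]≡n k≤a) ⟩
    vkFun λ₁ λ₂ a (toℕ p)          ≡⟨ sym (v-isVk p) ⟩
    toℕ (v ⟨$⟩ʳ p)                 ∎)
    where open ≡-Reasoning

-- A Grassmannian v above v_k is some v_a with k ≤ a ≤ λ₂, the entry 1 sitting at position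
-- a + 1: the entries after position λ₂ + 1 are forced to be 2, …, λ₁ in order, and the
-- remaining positions carry λ₁ + 1, …, n in order.
module GrassmannianAboveVk {n : ℕ} (λ₁ λ₂ k : ℕ) (1≤λ₁ : 1 ≤ λ₁) (λ-sum : λ₁ + λ₂ ≡ n) (k≤λ₂ : k ≤ λ₂)
  (v : Perm n) (v-grass : InλSn λ₁ v) (v-above : AboveVk λ₁ λ₂ k (v ⟨$⟩ʳ_)) where

  open PermOnℕ v

  bound : ∀ {m} → m < λ₁ + λ₂ → m < n
  bound = subst (_ <_) λ-sum

  ≤λ₂⇒<n : ∀ {p} → p ≤ λ₂ → p < n
  ≤λ₂⇒<n {p} p≤λ₂ = bound (subst (p <_) (+-comm λ₂ λ₁) (≤-<-trans p≤λ₂ (m<m+n λ₂ 1≤λ₁)))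

  tail<n : ∀ {s} → s < λ₁ → λ₂ + s < n
  tail<n {s} s<λ₁ = bound (subst (λ₂ + s <_) (+-comm λ₂ λ₁) (+-monoʳ-< λ₂ s<λ₁))

  V⁻¹-increasing : ∀ {s t} → s < t → t < n → (t < λ₁ ⊎ λ₁ ≤ s) → V⁻¹ s < V⁻¹ t
  V⁻¹-increasing {s} {t} s<t t<n same-block =
    subst₂ _<_ (sym (onℕ-fromℕ< _ s<n)) (sym (onℕ-fromℕ< _ t<n))
      (v-grass (fromℕ< s<n) (fromℕ< t<n) (subst₂ _<_ (sym (toℕ-fromℕ< s<n)) (sym (toℕ-fromℕ< t<n)) s<t)
        (Sum.map (subst (_< λ₁) (sym (toℕ-fromℕ< t<n))) (subst (λ₁ ≤_) (sym (toℕ-fromℕ< s<n))) same-block))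
    where
    s<n : s < n
    s<n = <-trans s<t t<n

  V-big : ∀ {p} → p < k → λ₁ ≤ V p
  V-big {p} p<k = subst (λ₁ ≤_) (sym (onℕ-fromℕ< _ p<n)) (proj₁ v-above _ (subst (_< k) (sym (toℕ-fromℕ< p<n)) p<k))
    where
    p<n : p < n
    p<n = ≤λ₂⇒<n (<⇒≤ (<-≤-trans p<k k≤λ₂))

  V-small : ∀ {p} → λ₂ < p → p < n → V p < λ₁
  V-small λ₂<p p<n = subst (_< λ₁) (sym (onℕ-fromℕ< _ p<n)) (proj₂ v-above _ (subst (λ₂ <_) (sym (toℕ-fromℕ< p<n)) λ₂<p))

  0<n : 0 < n
  0<n = bound (≤-trans 1≤λ₁ (m≤m+n λ₁ λ₂))

  a : ℕ
  a = V⁻¹ 0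

  V-a : V a ≡ 0
  V-a = V-V⁻¹ 0<n

  k≤a : k ≤ a
  k≤a with k ≤? a
  ... | yes k≤a = k≤a
  ... | no k≰a = ⊥-elim (<⇒≱ 1≤λ₁ (subst (λ₁ ≤_) V-a (V-big (≰⇒> k≰a))))

  a≤λ₂ : a ≤ λ₂
  a≤λ₂ = +-cancelʳ-≤ (λ₁ ∸ 1) a λ₂ (≤-pred (begin
    suc (a + (λ₁ ∸ 1))  ≤⟨ s≤s (increasing-+-≤ V⁻¹-small-increasing 0 (λ₁ ∸ 1) z≤n λ₁-1<λ₁) ⟩
    suc (V⁻¹ (λ₁ ∸ 1))  ≤⟨ subst (V⁻¹ (λ₁ ∸ 1) <_) (sym λ-sum) (onℕ-< _ (bound (<-≤-trans λ₁-1<λ₁ (m≤m+n λ₁ λ₂)))) ⟩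
    λ₁ + λ₂             ≡⟨ +-comm λ₁ λ₂ ⟩
    λ₂ + λ₁             ≡⟨ cong (λ m → λ₂ + m) (sym (m+[n∸m]≡n 1≤λ₁)) ⟩
    λ₂ + suc (λ₁ ∸ 1)   ≡⟨ +-suc λ₂ (λ₁ ∸ 1) ⟩
    suc (λ₂ + (λ₁ ∸ 1)) ∎))
    where
    open ≤-Reasoning
    λ₁-1<λ₁ : λ₁ ∸ 1 < λ₁
    λ₁-1<λ₁ = ≤-reflexive (m+[n∸m]≡n 1≤λ₁)
    V⁻¹-small-increasing : StrictlyIncreasingOn 0 λ₁ V⁻¹
    V⁻¹-small-increasing s t _ s<t t<λ₁ = V⁻¹-increasing s<t (bound (<-≤-trans t<λ₁ (m≤m+n λ₁ λ₂))) (inj₁ t<λ₁)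

  V-tail : ∀ s → 1 ≤ s → s < λ₁ → V (λ₂ + s) ≡ s
  V-tail = increasing-endo⇒id tail-increasing tail-into
    where
    tail-increasing : StrictlyIncreasingOn 1 λ₁ (λ s → V (λ₂ + s))
    tail-increasing s t 1≤s s<t t<λ₁ with <-cmp (V (λ₂ + s)) (V (λ₂ + t))
    ... | tri< lt _ _ = lt
    ... | tri≈ _ eq _ = ⊥-elim (<-irrefl (+-cancelˡ-≡ λ₂ _ _ (V-injective (tail<n (<-trans s<t t<λ₁)) (tail<n t<λ₁) eq)) s<t)
    ... | tri> _ _ gt = ⊥-elim (<-asym (+-monoʳ-< λ₂ s<t)
          (subst₂ _<_ (V⁻¹-V (tail<n t<λ₁)) (V⁻¹-V (tail<n (<-trans s<t t<λ₁)))
            (V⁻¹-increasing gt (onℕ-< _ (tail<n (<-trans s<t t<λ₁))) (inj₁ (V-small (m<m+n λ₂ 1≤s) (tail<n (<-trans s<t t<λ₁)))))))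
    tail-into : ∀ s → 1 ≤ s → s < λ₁ → 1 ≤ V (λ₂ + s) × V (λ₂ + s) < λ₁
    tail-into s 1≤s s<λ₁ = n≢0⇒n>0 V≢0 , V-small (m<m+n λ₂ 1≤s) (tail<n s<λ₁)
      where
      V≢0 : V (λ₂ + s) ≢ 0
      V≢0 V≡0 = <-irrefl refl (≤-<-trans a≤λ₂ (subst (λ₂ <_) (sym a≡λ₂+s) (m<m+n λ₂ 1≤s)))
        where
        a≡λ₂+s : a ≡ λ₂ + s
        a≡λ₂+s = trans (cong V⁻¹ (sym V≡0)) (V⁻¹-V (tail<n s<λ₁))

  V-big-≢a : ∀ {p} → p ≤ λ₂ → p ≢ a → λ₁ ≤ V p
  V-big-≢a {p} p≤λ₂ p≢a with λ₁ ≤? V p | V p ≟ 0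
  ... | yes λ₁≤Vp | _ = λ₁≤Vp
  ... | no _ | yes Vp≡0 = ⊥-elim (p≢a (trans (sym (V⁻¹-V (≤λ₂⇒<n p≤λ₂))) (cong V⁻¹ Vp≡0)))
  ... | no λ₁≰Vp | no Vp≢0 = ⊥-elim (<-irrefl refl (≤-<-trans p≤λ₂ (subst (λ₂ <_) λ₂+Vp≡p (m<m+n λ₂ (n≢0⇒n>0 Vp≢0)))))
    where
    λ₂+Vp≡p : λ₂ + V p ≡ p
    λ₂+Vp≡p = V-injective (tail<n (≰⇒> λ₁≰Vp)) (≤λ₂⇒<n p≤λ₂) (V-tail (V p) (n≢0⇒n>0 Vp≢0) (≰⇒> λ₁≰Vp))

  -- q ↦ the q-th position of [0, λ₂] other than a
  skip : ℕ → ℕ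
  skip q with q <? a
  ... | yes _ = q
  ... | no _ = suc q

  skip-< : ∀ {q} → q < a → skip q ≡ q
  skip-< {q} q<a with q <? a
  ... | yes _ = refl
  ... | no q≮a = ⊥-elim (q≮a q<a)

  skip-≥ : ∀ {q} → a ≤ q → skip q ≡ suc q
  skip-≥ {q} a≤q with q <? a
  ... | yes q<a = ⊥-elim (<-irrefl refl (<-≤-trans q<a a≤q))
  ... | no _ = refl

  skip-range : ∀ {q} → q < λ₂ → skip q ≤ λ₂ × skip q ≢ a
  skip-range {q} q<λ₂ with q <? a
  ... | yes q<a = <⇒≤ q<λ₂ , λ q≡a → <-irrefl q≡a q<a
  ... | no q≮a = q<λ₂ , λ 1+q≡a → q≮a (subst (q <_) 1+q≡a (n<1+n q))

  skip-increasing : ∀ {q r} → q < r → skip q < skip r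
  skip-increasing {q} {r} q<r with q <? a | r <? a
  ... | yes _ | yes _ = q<r
  ... | yes _ | no _ = <-trans q<r (n<1+n r)
  ... | no q≮a | yes r<a = ⊥-elim (q≮a (<-trans q<r r<a))
  ... | no _ | no _ = s≤s q<r

  V-skip : ∀ q → q < λ₂ → V (skip q) ≡ λ₁ + q
  V-skip q q<λ₂ = trans (sym (m+[n∸m]≡n (big q<λ₂)))
                        (cong (λ m → λ₁ + m) (increasing-endo⇒id g-increasing g-into q z≤n q<λ₂))
    where
    skip<n : ∀ {q} → q < λ₂ → skip q < n
    skip<n q<λ₂ = ≤λ₂⇒<n (proj₁ (skip-range q<λ₂))
    big : ∀ {q} → q < λ₂ → λ₁ ≤ V (skip q)
    big q<λ₂ = V-big-≢a (proj₁ (skip-range q<λ₂)) (proj₂ (skip-range q<λ₂))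
    g : ℕ → ℕ
    g q = V (skip q) ∸ λ₁
    g-increasing : StrictlyIncreasingOn 0 λ₂ g
    g-increasing s t _ s<t t<λ₂ = ∸-monoˡ-< V-skip-< (big (<-trans s<t t<λ₂))
      where
      s<λ₂ : s < λ₂
      s<λ₂ = <-trans s<t t<λ₂
      V-skip-< : V (skip s) < V (skip t)
      V-skip-< with <-cmp (V (skip s)) (V (skip t))
      ... | tri< lt _ _ = lt
      ... | tri≈ _ eq _ = ⊥-elim (<-irrefl (V-injective (skip<n s<λ₂) (skip<n t<λ₂) eq) (skip-increasing s<t))
      ... | tri> _ _ gt = ⊥-elim (<-asym (skip-increasing s<t)
            (subst₂ _<_ (V⁻¹-V (skip<n t<λ₂)) (V⁻¹-V (skip<n s<λ₂))
              (V⁻¹-increasing gt (onℕ-< _ (skip<n s<λ₂)) (inj₂ (big t<λ₂)))))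
    g-into : ∀ s → 0 ≤ s → s < λ₂ → 0 ≤ g s × g s < λ₂
    g-into s _ s<λ₂ = z≤n , subst (g s <_) (m+n∸m≡n λ₁ λ₂)
      (∸-monoˡ-< (subst (V (skip s) <_) (sym λ-sum) (onℕ-< _ (skip<n s<λ₂))) (big s<λ₂))

  V≡vkFun : ∀ p → p < n → V p ≡ vkFun λ₁ λ₂ a p
  V≡vkFun p p<n with vkFunView λ₁ λ₂ a p a≤λ₂
  ... | before p<a e = trans (cong V (sym (skip-< p<a))) (trans (V-skip p (<-≤-trans p<a a≤λ₂)) (sym e))
  ... | at refl e = trans V-a (sym e)
  ... | middle a<p p≤λ₂ e = begin
    V p                ≡⟨ cong V (sym skip-p-1) ⟩
    V (skip (p ∸ 1))   ≡⟨ V-skip (p ∸ 1) (subst (_≤ λ₂) (sym 1+[p-1]≡p) p≤λ₂) ⟩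
    λ₁ + (p ∸ 1)       ≡⟨ sym (+-∸-assoc λ₁ 1≤p) ⟩
    λ₁ + p ∸ 1         ≡⟨ sym e ⟩
    vkFun λ₁ λ₂ a p    ∎
    where
    open ≡-Reasoning
    1≤p : 1 ≤ p
    1≤p = ≤-trans (s≤s z≤n) a<p
    1+[p-1]≡p : suc (p ∸ 1) ≡ p
    1+[p-1]≡p = m+[n∸m]≡n 1≤p
    skip-p-1 : skip (p ∸ 1) ≡ p
    skip-p-1 = trans (skip-≥ (≤-pred (subst (a <_) (sym 1+[p-1]≡p) a<p))) 1+[p-1]≡p
  ... | after λ₂<p e = begin
    V p                ≡⟨ cong V (sym λ₂+[p-λ₂]≡p) ⟩
    V (λ₂ + (p ∸ λ₂))  ≡⟨ V-tail (p ∸ λ₂) (m<n⇒0<n∸m λ₂<p) p-λ₂<λ₁ ⟩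
    p ∸ λ₂             ≡⟨ sym e ⟩
    vkFun λ₁ λ₂ a p    ∎
    where
    open ≡-Reasoning
    λ₂+[p-λ₂]≡p : λ₂ + (p ∸ λ₂) ≡ p
    λ₂+[p-λ₂]≡p = m+[n∸m]≡n (<⇒≤ λ₂<p)
    p-λ₂<λ₁ : p ∸ λ₂ < λ₁
    p-λ₂<λ₁ = vkFun-after-< 1≤λ₁ (subst (p <_) (sym λ-sum) p<n)

  v-isVk : IsVk λ₁ λ₂ a v
  v-isVk x = trans (sym (onℕ-toℕ _ x)) (V≡vkFun (toℕ x) (toℕ<n x))

Grassmannian-AboveVk⇒IsVk : ∀ {n} (λ₁ λ₂ k : ℕ) → 1 ≤ λ₁ → λ₁ + λ₂ ≡ n → k ≤ λ₂ →
  (v : Perm n) → InλSn λ₁ v → AboveVk λ₁ λ₂ k (v ⟨$⟩ʳ_) →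
  Σ ℕ λ a → k ≤ a × a ≤ λ₂ × IsVk λ₁ λ₂ a v
Grassmannian-AboveVk⇒IsVk λ₁ λ₂ k 1≤λ₁ λ-sum k≤λ₂ v v-grass v-above = a , k≤a , a≤λ₂ , v-isVk
  where open GrassmannianAboveVk λ₁ λ₂ k 1≤λ₁ λ-sum k≤λ₂ v v-grass v-above

-- The factorization w = y v with y ∈ S_λ and v ∈ ^λS_n

PreservesBlocks : ℕ → (Fin n → Fin n) → Set
PreservesBlocks λ₁ f = ∀ s → (toℕ s < λ₁ → toℕ (f s) < λ₁) × (toℕ (f s) < λ₁ → toℕ s < λ₁)

module _ {λ₁ : ℕ} where

  PreservesBlocks-id : PreservesBlocks {n} λ₁ (λ s → s)
  PreservesBlocks-id s = (λ s<λ₁ → s<λ₁) , (λ s<λ₁ → s<λ₁)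

  PreservesBlocks-∘ : {f g : Fin n → Fin n} → PreservesBlocks λ₁ f → PreservesBlocks λ₁ g →
    PreservesBlocks λ₁ (f ∘ g)
  PreservesBlocks-∘ {g = g} f-pres g-pres s =
    proj₁ (f-pres (g s)) ∘ proj₁ (g-pres s) , proj₂ (g-pres s) ∘ proj₂ (f-pres (g s))

  PreservesBlocks-resp : {f g : Fin n → Fin n} → (∀ x → f x ≡ g x) → PreservesBlocks λ₁ f → PreservesBlocks λ₁ g
  PreservesBlocks-resp f≗g f-pres s =
    subst (λ z → toℕ z < λ₁) (f≗g s) ∘ proj₁ (f-pres s) , proj₂ (f-pres s) ∘ subst (λ z → toℕ z < λ₁) (sym (f≗g s))

  swap-PreservesBlocks : (c d : Fin n) → (toℕ c < λ₁ → toℕ d < λ₁) → (toℕ d < λ₁ → toℕ c < λ₁) →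
    PreservesBlocks λ₁ (swap c d)
  swap-PreservesBlocks c d c⇒d d⇒c s with swapView c d s
  ... | at-left refl e = subst (λ z → toℕ z < λ₁) (sym e) ∘ c⇒d , d⇒c ∘ subst (λ z → toℕ z < λ₁) e
  ... | at-right _ refl e = subst (λ z → toℕ z < λ₁) (sym e) ∘ d⇒c , c⇒d ∘ subst (λ z → toℕ z < λ₁) e
  ... | elsewhere _ _ e = subst (λ z → toℕ z < λ₁) (sym e) , subst (λ z → toℕ z < λ₁) e

  generator-PreservesBlocks : (a b : Fin n) → IsGenλ λ₁ (a , b) → PreservesBlocks λ₁ (swap a b)
  generator-PreservesBlocks a b (b≡1+a , 1+a≢λ₁) = swap-PreservesBlocks a b a⇒b b⇒a
    where
    a⇒b : toℕ a < λ₁ → toℕ b < λ₁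
    a⇒b a<λ₁ with m≤n⇒m<n∨m≡n a<λ₁
    ... | inj₁ 1+a<λ₁ = subst (_< λ₁) (sym b≡1+a) 1+a<λ₁
    ... | inj₂ 1+a≡λ₁ = ⊥-elim (1+a≢λ₁ 1+a≡λ₁)
    b⇒a : toℕ b < λ₁ → toℕ a < λ₁
    b⇒a b<λ₁ = <-trans (n<1+n (toℕ a)) (subst (_< λ₁) b≡1+a b<λ₁)

  wordProd-PreservesBlocks : (ws : List (Pair n)) → All (IsGenλ λ₁) ws → PreservesBlocks λ₁ (wordProd ws ⟨$⟩ʳ_)
  wordProd-PreservesBlocks [] [] = PreservesBlocks-id
  wordProd-PreservesBlocks ((a , b) ∷ ws) (gen ∷ gens) =
    PreservesBlocks-∘ (generator-PreservesBlocks a b gen) (wordProd-PreservesBlocks ws gens)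

  Sλ-PreservesBlocks : (y : Perm n) → InSλ λ₁ y → PreservesBlocks λ₁ (y ⟨$⟩ʳ_)
  Sλ-PreservesBlocks y (ws , gens , y≈) = PreservesBlocks-resp (sym ∘ y≈) (wordProd-PreservesBlocks ws gens)

wordProd-snoc : (ws : List (Pair n)) (a b x : Fin n) →
  wordProd (ws ++ [ (a , b) ]) ⟨$⟩ʳ x ≡ wordProd ws ⟨$⟩ʳ swap a b x
wordProd-snoc [] a b x = refl
wordProd-snoc ((c , d) ∷ ws) a b x = cong (swap c d) (wordProd-snoc ws a b x)

module _ {n λ₁ : ℕ} {y : Fin n → Fin n} (y-pres : PreservesBlocks λ₁ y) {u w : Fin n → Fin n}
         (w≗yu : ∀ x → w x ≡ y (u x)) where

  small⇒small : ∀ x → toℕ (u x) < λ₁ → toℕ (w x) < λ₁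
  small⇒small x ux<λ₁ = subst (λ z → toℕ z < λ₁) (sym (w≗yu x)) (proj₁ (y-pres (u x)) ux<λ₁)

  small⇐small : ∀ x → toℕ (w x) < λ₁ → toℕ (u x) < λ₁
  small⇐small x wx<λ₁ = proj₂ (y-pres (u x)) (subst (λ z → toℕ z < λ₁) (w≗yu x) wx<λ₁)

  AboveVk-blockwise : ∀ {λ₂ k} → AboveVk λ₁ λ₂ k u → AboveVk λ₁ λ₂ k w
  AboveVk-blockwise (big , small) =
    (λ x x<k → ≮⇒≥ (λ wx<λ₁ → <⇒≱ (small⇐small x wx<λ₁) (big x x<k))) ,
    (λ x λ₂<x → small⇒small x (small x λ₂<x))

  AboveVk-blockwise⁻ : ∀ {λ₂ k} → AboveVk λ₁ λ₂ k w → AboveVk λ₁ λ₂ k u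
  AboveVk-blockwise⁻ (big , small) =
    (λ x x<k → ≮⇒≥ (λ ux<λ₁ → <⇒≱ (small⇒small x ux<λ₁) (big x x<k))) ,
    (λ x λ₂<x → small⇐small x (small x λ₂<x))

-- Bubble sort: while v⁻¹ = w⁻¹ y has a descent at some s_r ∈ S_λ, replace y by y s_r.
module Factorization {n : ℕ} (λ₁ : ℕ) (w : Perm n) where

  private
    v⁻¹ : List (Pair n) → Perm n
    v⁻¹ ws = flip w · wordProd ws

    BlockSorted : List (Pair n) → Set
    BlockSorted ws = ∀ a b → toℕ a < toℕ b → (toℕ b < λ₁ ⊎ λ₁ ≤ toℕ a) →
      toℕ (v⁻¹ ws ⟨$⟩ʳ a) < toℕ (v⁻¹ ws ⟨$⟩ʳ b)

    Descent : List (Pair n) → Fin n → Fin n → Set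
    Descent ws r r′ = IsGenλ λ₁ (r , r′) × toℕ (v⁻¹ ws ⟨$⟩ʳ r′) < toℕ (v⁻¹ ws ⟨$⟩ʳ r)

    descent? : ∀ ws → Dec (∃ λ r → ∃ λ r′ → Descent ws r r′)
    descent? ws = any? λ r → any? λ r′ →
      ((toℕ r′ ≟ suc (toℕ r)) ×-dec ¬? (suc (toℕ r) ≟ λ₁)) ×-dec (toℕ (v⁻¹ ws ⟨$⟩ʳ r′) <? toℕ (v⁻¹ ws ⟨$⟩ʳ r))

    no-descent⇒BlockSorted : ∀ ws → ¬ (∃ λ r → ∃ λ r′ → Descent ws r r′) → BlockSorted ws
    no-descent⇒BlockSorted ws no-descent a b a<b same-block =
      subst₂ _<_ (onℕ-toℕ _ a) (onℕ-toℕ _ b) (within same-block)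
      where
      open PermOnℕ (v⁻¹ ws) using (V; V-injective)
      adjacent : ∀ r → suc r < n → suc r ≢ λ₁ → V r < V (suc r)
      adjacent r 1+r<n 1+r≢λ₁ with <-cmp (V r) (V (suc r))
      ... | tri< lt _ _ = lt
      ... | tri≈ _ eq _ = ⊥-elim (<-irrefl (V-injective r<n 1+r<n eq) (n<1+n r))
        where
        r<n : r < n
        r<n = <-trans (n<1+n r) 1+r<n
      ... | tri> _ _ gt = ⊥-elim (no-descent (fromℕ< r<n , fromℕ< 1+r<n ,
            (trans (toℕ-fromℕ< 1+r<n) (cong suc (sym (toℕ-fromℕ< r<n))) ,
             (λ e → 1+r≢λ₁ (trans (cong suc (sym (toℕ-fromℕ< r<n))) e))) ,
            subst₂ _<_ (onℕ-fromℕ< _ 1+r<n) (onℕ-fromℕ< _ r<n) gt))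
        where
        r<n : r < n
        r<n = <-trans (n<1+n r) 1+r<n
      within : (toℕ b < λ₁ ⊎ λ₁ ≤ toℕ a) → V (toℕ a) < V (toℕ b)
      within (inj₁ b<λ₁) = adjacent-increasing⇒increasing {lo = 0} {hi = suc (toℕ b)}
        (λ r _ 1+r≤b → adjacent r (≤-<-trans (≤-pred 1+r≤b) (toℕ<n b)) λ e → <-irrefl e (≤-<-trans (≤-pred 1+r≤b) b<λ₁))
        (toℕ a) (toℕ b) z≤n a<b ≤-refl
      within (inj₂ λ₁≤a) = adjacent-increasing⇒increasing {lo = λ₁} {hi = n}
        (λ r λ₁≤r 1+r<n → adjacent r 1+r<n λ e → <-irrefl (sym e) (s≤s λ₁≤r))
        (toℕ a) (toℕ b) λ₁≤a a<b (toℕ<n b)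

    sort : ∀ ws → All (IsGenλ λ₁) ws → Acc _<_ (ℓ (v⁻¹ ws)) →
      Σ (List (Pair n)) λ ws′ → All (IsGenλ λ₁) ws′ × BlockSorted ws′
    sort ws gens (acc rec) with descent? ws
    ... | no no-descent = ws , gens , no-descent⇒BlockSorted ws no-descent
    ... | yes (r , r′ , gen , descent) = sort (ws ++ [ (r , r′) ]) (All.++⁺ gens (gen ∷ [])) (rec ℓ-<)
      where
      r<r′ : toℕ r < toℕ r′
      r<r′ = subst (toℕ r <_) (sym (proj₁ gen)) (n<1+n _)
      ℓ-< : ℓ (v⁻¹ (ws ++ [ (r , r′) ])) < ℓ (v⁻¹ ws)
      ℓ-< = subst (_< ℓ (v⁻¹ ws))
        (ℓ-cong (v⁻¹ ws · transpose r r′) (v⁻¹ (ws ++ [ (r , r′) ])) (λ x → cong (flip w ⟨$⟩ʳ_) (sym (wordProd-snoc ws r r′ x))))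
        (ℓ-swap-inversion (v⁻¹ ws) r r′ r<r′ descent)

    sorted : Σ (List (Pair n)) λ ws → All (IsGenλ λ₁) ws × BlockSorted ws
    sorted = sort [] [] (<-wellFounded _)

  y : Perm n
  y = wordProd (proj₁ sorted)

  v : Perm n
  v = w ∘ₚ flip y

  y∈Sλ : InSλ λ₁ y
  y∈Sλ = proj₁ sorted , proj₁ (proj₂ sorted) , λ _ → refl

  v∈λSn : InλSn λ₁ v
  v∈λSn = proj₂ (proj₂ sorted)

  w≈yv : w ≈ₚ (y · v)
  w≈yv x = sym (inverseʳ y)

  y-PreservesBlocks : PreservesBlocks λ₁ (y ⟨$⟩ʳ_)
  y-PreservesBlocks = Sλ-PreservesBlocks y y∈Sλ

-- Uniqueness: c = v₂ v₁⁻¹ preserves the blocks and is increasing on each, so c = id.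
module FactorizationUnique {n : ℕ} (λ₁ : ℕ) (λ₁≤n : λ₁ ≤ n) (v₁ v₂ : Perm n)
  (v₁-grass : InλSn λ₁ v₁) (v₂-grass : InλSn λ₁ v₂) (y₁ y₂ : Fin n → Fin n)
  (y₁-pres : PreservesBlocks λ₁ y₁) (y₂-pres : PreservesBlocks λ₁ y₂)
  (y₁v₁≗y₂v₂ : ∀ x → y₁ (v₁ ⟨$⟩ʳ x) ≡ y₂ (v₂ ⟨$⟩ʳ x)) where

  private
    c : Fin n → Fin n
    c s = v₂ ⟨$⟩ʳ (v₁ ⟨$⟩ˡ s)

    y₁≗y₂c : ∀ s → y₁ s ≡ y₂ (c s)
    y₁≗y₂c s = trans (cong y₁ (sym (inverseʳ v₁))) (y₁v₁≗y₂v₂ (v₁ ⟨$⟩ˡ s))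

    c-pres : PreservesBlocks λ₁ c
    c-pres s = (λ s<λ₁ → proj₂ (y₂-pres (c s)) (subst (λ z → toℕ z < λ₁) (y₁≗y₂c s) (proj₁ (y₁-pres s) s<λ₁))) ,
               (λ cs<λ₁ → proj₂ (y₁-pres s) (subst (λ z → toℕ z < λ₁) (sym (y₁≗y₂c s)) (proj₁ (y₂-pres (c s)) cs<λ₁)))

    c-increasing : ∀ s t → toℕ s < toℕ t → (toℕ t < λ₁ ⊎ λ₁ ≤ toℕ s) → toℕ (c s) < toℕ (c t)
    c-increasing s t s<t same-block with <-cmp (toℕ (c s)) (toℕ (c t))
    ... | tri< lt _ _ = lt
    ... | tri≈ _ eq _ = ⊥-elim (<-irrefl (cong toℕ (permute-injective (flip v₁) (toℕ-permute-injective v₂ eq))) s<t)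
    ... | tri> _ _ gt = ⊥-elim (<-asym (v₁-grass s t s<t same-block)
          (subst₂ _<_ (cong toℕ (inverseˡ v₂)) (cong toℕ (inverseˡ v₂)) (v₂-grass (c t) (c s) gt (image-block same-block))))
      where
      image-block : (toℕ t < λ₁ ⊎ λ₁ ≤ toℕ s) → (toℕ (c s) < λ₁ ⊎ λ₁ ≤ toℕ (c t))
      image-block (inj₁ t<λ₁) = inj₁ (proj₁ (c-pres s) (<-trans s<t t<λ₁))
      image-block (inj₂ λ₁≤s) = inj₂ (≮⇒≥ λ ct<λ₁ → <⇒≱ (proj₂ (c-pres t) ct<λ₁) (≤-trans λ₁≤s (<⇒≤ s<t)))

    C : ℕ → ℕ
    C = onℕ c

    C-increasing : ∀ {s t} → s < t → t < n → (t < λ₁ ⊎ λ₁ ≤ s) → C s < C t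
    C-increasing {s} {t} s<t t<n same-block = subst₂ _<_ (sym (onℕ-fromℕ< c s<n)) (sym (onℕ-fromℕ< c t<n))
      (c-increasing _ _ (subst₂ _<_ (sym (toℕ-fromℕ< s<n)) (sym (toℕ-fromℕ< t<n)) s<t)
        (Sum.map (subst (_< λ₁) (sym (toℕ-fromℕ< t<n))) (subst (λ₁ ≤_) (sym (toℕ-fromℕ< s<n))) same-block))
      where
      s<n : s < n
      s<n = <-trans s<t t<n

    C-id : ∀ s → s < n → C s ≡ s
    C-id s s<n with s <? λ₁
    ... | yes s<λ₁ = increasing-endo⇒id (λ a b _ a<b b<λ₁ → C-increasing a<b (<-≤-trans b<λ₁ λ₁≤n) (inj₁ b<λ₁))
      (λ a _ a<λ₁ → z≤n , subst (_< λ₁) (sym (onℕ-fromℕ< c (<-≤-trans a<λ₁ λ₁≤n)))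
                            (proj₁ (c-pres _) (subst (_< λ₁) (sym (toℕ-fromℕ< _)) a<λ₁)))
      s z≤n s<λ₁
    ... | no s≮λ₁ = increasing-endo⇒id (λ a b λ₁≤a a<b b<n → C-increasing a<b b<n (inj₂ λ₁≤a))
      (λ a λ₁≤a a<n → ≮⇒≥ (λ Ca<λ₁ → <⇒≱ (subst (_< λ₁) (toℕ-fromℕ< a<n)
                                          (proj₂ (c-pres _) (subst (_< λ₁) (onℕ-fromℕ< c a<n) Ca<λ₁))) λ₁≤a) ,
                        onℕ-< c a<n)
      s (≮⇒≥ s≮λ₁) s<n

    c-id : ∀ s → c s ≡ s
    c-id s = toℕ-injective (trans (sym (onℕ-toℕ c s)) (C-id (toℕ s) (toℕ<n s)))

  v₁≈v₂ : v₁ ≈ₚ v₂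
  v₁≈v₂ x = sym (trans (cong (v₂ ⟨$⟩ʳ_) (sym (inverseˡ v₁))) (c-id (v₁ ⟨$⟩ʳ x)))

  y₁≗y₂ : ∀ s → y₁ s ≡ y₂ s
  y₁≗y₂ s = trans (y₁≗y₂c s) (cong y₂ (c-id s))

-- Polynomial identities

≈P-reflexive : {p q : Poly n} → p ≡ q → p ≈P q
≈P-reflexive refl R ρ = CommutativeRing.refl R

≈P-trans : {p q r : Poly n} → p ≈P q → q ≈P r → p ≈P r
≈P-trans p≈q q≈r R ρ = CommutativeRing.trans R (p≈q R ρ) (q≈r R ρ)

∣P-resp : {a b a′ b′ d : Poly n} → a ≈P a′ → b ≈P b′ → d ∣P (a′ -ₚ b′) → d ∣P (a -ₚ b)
∣P-resp a≈a′ b≈b′ (q , a′-b′≈dq) = q , λ R ρ →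
  CommutativeRing.trans R (CommutativeRing.+-cong R (a≈a′ R ρ) (CommutativeRing.-‿cong R (b≈b′ R ρ))) (a′-b′≈dq R ρ)

∣P-0-0 : {d : Poly n} → d ∣P (con (+ 0) -ₚ con (+ 0))
∣P-0-0 = con (+ 0) , λ R ρ →
  CommutativeRing.trans R (CommutativeRing.-‿inverseʳ R _) (CommutativeRing.sym R (CommutativeRing.zeroʳ R _))

∣P-≈ : {d p q : Poly n} → p ≈P q → d ∣P (p -ₚ q)
∣P-≈ p≈q = con (+ 0) , λ R ρ →
  let open CommutativeRing R using (+-congˡ; -‿cong; -‿inverseʳ; zeroʳ) renaming (sym to ≈-sym; trans to ≈-trans) in
  ≈-trans (+-congˡ (-‿cong (≈-sym (p≈q R ρ)))) (≈-trans (-‿inverseʳ _) (≈-sym (zeroʳ _)))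

GKM-resp : {h : Fin n → Fin n} {f g : Perm n → Poly n} → (∀ w → f w ≈P g w) → GKM h g → GKM h f
GKM-resp {f = f} {g} f≈g g-GKM w i j γ =
  ∣P-resp {a = f w} {f w′} {g w} {g w′} {t (w ⟨$⟩ʳ i) -ₚ t (w ⟨$⟩ʳ j)} (f≈g w) (f≈g w′) (g-GKM w i j γ)
  where w′ = w · transpose i j

Homogeneous-resp : {d : ℕ} {p q : Poly n} → p ≈P q → Homogeneous d q → Homogeneous d p
Homogeneous-resp p≈q q-hom R ρ c = ≈-trans (p≈q R _) (≈-trans (q-hom R ρ c) (*-congˡ (≈-sym (p≈q R ρ))))
  where open CommutativeRing R using (*-congˡ) renaming (sym to ≈-sym; trans to ≈-trans)

Homogeneous-0 : (d : ℕ) → Homogeneous {n} d (con (+ 0))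
Homogeneous-0 d R ρ c = CommutativeRing.sym R (CommutativeRing.zeroʳ R _)

module RingLemmas (R : CommutativeRing 0ℓ 0ℓ) where
  open CommutativeRing R renaming (_+_ to _+ᴿ_; sym to ≈-sym)
  open import Algebra.Properties.Ring ring using (x[y-z]≈xy-xz; [y-z]x≈yx-zx)
  open import Algebra.Properties.CommutativeSemigroup +-commutativeSemigroup using (interchange)
  open import Algebra.Properties.AbelianGroup +-abelianGroup using (⁻¹-∙-comm)
  open import Relation.Binary.Reasoning.Setoid setoid

  ℤ→R-1 : ℤ→R R (+ 1) ≈ 1#
  ℤ→R-1 = +-identityʳ 1#

  -‿+-interchange : ∀ a b c d → (a +ᴿ b) - (c +ᴿ d) ≈ (a - c) +ᴿ (b - d)
  -‿+-interchange a b c d = begin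
    (a +ᴿ b) +ᴿ - (c +ᴿ d)    ≈⟨ +-congˡ (≈-sym (⁻¹-∙-comm c d)) ⟩
    (a +ᴿ b) +ᴿ (- c +ᴿ - d)  ≈⟨ interchange a b (- c) (- d) ⟩
    (a - c) +ᴿ (b - d)        ∎

  -‿*-leibniz : ∀ a b c d → a * b - c * d ≈ (a - c) * b +ᴿ c * (b - d)
  -‿*-leibniz a b c d = ≈-sym (begin
    (a - c) * b +ᴿ c * (b - d)               ≈⟨ +-cong ([y-z]x≈yx-zx b a c) (x[y-z]≈xy-xz c b d) ⟩
    (a * b - c * b) +ᴿ (c * b - c * d)       ≈⟨ +-assoc (a * b) (- (c * b)) (c * b - c * d) ⟩
    a * b +ᴿ (- (c * b) +ᴿ (c * b - c * d))  ≈⟨ +-congˡ (≈-sym (+-assoc (- (c * b)) (c * b) (- (c * d)))) ⟩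
    a * b +ᴿ ((- (c * b) +ᴿ c * b) - c * d)  ≈⟨ +-congˡ (+-congʳ (-‿inverseˡ (c * b))) ⟩
    a * b +ᴿ (0# - c * d)                    ≈⟨ +-congˡ (+-identityˡ (- (c * d))) ⟩
    a * b - c * d                            ∎)

  -‿neg : ∀ a b → (- a) - (- b) ≈ - (a - b)
  -‿neg a b = ⁻¹-∙-comm a (- b)

-- The divided difference with respect to t_X and t_Y: p - (X Y)·p = (t_X - t_Y) ∂ p.
module DividedDifference (X Y : Fin n) where

  swapVars : Poly n → Poly n
  swapVars (var z) = var (swap X Y z)
  swapVars (con c) = con c
  swapVars (p +ₚ q) = swapVars p +ₚ swapVars q
  swapVars (p *ₚ q) = swapVars p *ₚ swapVars q
  swapVars (-ₚ p) = -ₚ swapVars p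

  ∂var : Fin n → Poly n
  ∂var z with z Fin.≟ X | z Fin.≟ Y
  ... | yes _ | _ = con (+ 1)
  ... | no _ | yes _ = -ₚ con (+ 1)
  ... | no _ | no _ = con (+ 0)

  ∂ : Poly n → Poly n
  ∂ (var z) = ∂var z
  ∂ (con c) = con (+ 0)
  ∂ (p +ₚ q) = ∂ p +ₚ ∂ q
  ∂ (p *ₚ q) = ∂ p *ₚ q +ₚ swapVars p *ₚ ∂ q
  ∂ (-ₚ p) = -ₚ ∂ p

  module _ (R : CommutativeRing 0ℓ 0ℓ) where
    open CommutativeRing R renaming (_+_ to _+ᴿ_; refl to ≈-refl; sym to ≈-sym; trans to ≈-trans)
    open RingLemmas R
    open import Algebra.Properties.Ring ring using (-‿distribʳ-*)
    open import Algebra.Properties.AbelianGroup +-abelianGroup using (⁻¹-anti-homo‿-)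
    open import Algebra.Properties.CommutativeSemigroup *-commutativeSemigroup using (x∙yz≈y∙xz)
    open import Relation.Binary.Reasoning.Setoid setoid

    swapVars-⟦⟧ : ∀ p (ρ : Fin n → Carrier) → ⟦ R ⟧ (swapVars p) ρ ≡ ⟦ R ⟧ p (ρ ∘ swap X Y)
    swapVars-⟦⟧ (var z) ρ = refl
    swapVars-⟦⟧ (con c) ρ = refl
    swapVars-⟦⟧ (p +ₚ q) ρ = cong₂ _+ᴿ_ (swapVars-⟦⟧ p ρ) (swapVars-⟦⟧ q ρ)
    swapVars-⟦⟧ (p *ₚ q) ρ = cong₂ _*_ (swapVars-⟦⟧ p ρ) (swapVars-⟦⟧ q ρ)
    swapVars-⟦⟧ (-ₚ p) ρ = cong -_ (swapVars-⟦⟧ p ρ)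

    ∂var-X : ∀ ρ → ⟦ R ⟧ (∂var X) ρ ≈ 1#
    ∂var-X ρ with X Fin.≟ X
    ... | yes _ = ℤ→R-1
    ... | no X≢X with () ← X≢X refl

    ∂var-Y : ∀ ρ → Y ≢ X → ⟦ R ⟧ (∂var Y) ρ ≈ - 1#
    ∂var-Y ρ Y≢X with Y Fin.≟ X | Y Fin.≟ Y
    ... | yes Y≡X | _ with () ← Y≢X Y≡X
    ... | no _ | yes _ = -‿cong ℤ→R-1
    ... | no _ | no Y≢Y with () ← Y≢Y refl

    ∂var-other : ∀ {z} ρ → z ≢ X → z ≢ Y → ⟦ R ⟧ (∂var z) ρ ≈ 0#
    ∂var-other {z} ρ z≢X z≢Y with z Fin.≟ X | z Fin.≟ Y
    ... | yes z≡X | _ with () ← z≢X z≡X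
    ... | no _ | yes z≡Y with () ← z≢Y z≡Y
    ... | no _ | no _ = ≈-refl

    ∂-spec : ∀ p (ρ : Fin n → Carrier) → ⟦ R ⟧ p ρ - ⟦ R ⟧ p (ρ ∘ swap X Y) ≈ (ρ X - ρ Y) * ⟦ R ⟧ (∂ p) ρ
    ∂-spec (var z) ρ with swapView X Y z
    ... | at-left refl e = begin
      ρ z - ρ (swap z Y z)           ≈⟨ reflexive (cong (λ u → ρ z - ρ u) e) ⟩
      ρ z - ρ Y                      ≈⟨ ≈-sym (*-identityʳ _) ⟩
      (ρ z - ρ Y) * 1#               ≈⟨ *-congˡ (≈-sym (∂var-X ρ)) ⟩
      (ρ z - ρ Y) * ⟦ R ⟧ (∂var z) ρ ∎
    ... | at-right z≢X refl e = begin
      ρ z - ρ (swap X z z)           ≈⟨ reflexive (cong (λ u → ρ z - ρ u) e) ⟩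
      ρ z - ρ X                      ≈⟨ ≈-sym (⁻¹-anti-homo‿- (ρ X) (ρ z)) ⟩
      - (ρ X - ρ z)                  ≈⟨ -‿cong (≈-sym (*-identityʳ _)) ⟩
      - ((ρ X - ρ z) * 1#)           ≈⟨ -‿distribʳ-* _ _ ⟩
      (ρ X - ρ z) * - 1#             ≈⟨ *-congˡ (≈-sym (∂var-Y ρ z≢X)) ⟩
      (ρ X - ρ z) * ⟦ R ⟧ (∂var z) ρ ∎
    ... | elsewhere z≢X z≢Y e = begin
      ρ z - ρ (swap X Y z)           ≈⟨ reflexive (cong (λ u → ρ z - ρ u) e) ⟩
      ρ z - ρ z                      ≈⟨ -‿inverseʳ _ ⟩
      0#                             ≈⟨ ≈-sym (zeroʳ _) ⟩
      (ρ X - ρ Y) * 0#               ≈⟨ *-congˡ (≈-sym (∂var-other ρ z≢X z≢Y)) ⟩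
      (ρ X - ρ Y) * ⟦ R ⟧ (∂var z) ρ ∎
    ∂-spec (con c) ρ = ≈-trans (-‿inverseʳ _) (≈-sym (zeroʳ _))
    ∂-spec (p +ₚ q) ρ = begin
      (P +ᴿ Q) - (P′ +ᴿ Q′)       ≈⟨ -‿+-interchange P Q P′ Q′ ⟩
      (P - P′) +ᴿ (Q - Q′)        ≈⟨ +-cong (∂-spec p ρ) (∂-spec q ρ) ⟩
      d * ∂P +ᴿ d * ∂Q            ≈⟨ ≈-sym (distribˡ d ∂P ∂Q) ⟩
      d * (∂P +ᴿ ∂Q)              ∎
      where
      P Q P′ Q′ ∂P ∂Q d : Carrier
      P = ⟦ R ⟧ p ρ ; Q = ⟦ R ⟧ q ρ ; d = ρ X - ρ Y
      P′ = ⟦ R ⟧ p (ρ ∘ swap X Y) ; Q′ = ⟦ R ⟧ q (ρ ∘ swap X Y)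
      ∂P = ⟦ R ⟧ (∂ p) ρ ; ∂Q = ⟦ R ⟧ (∂ q) ρ
    ∂-spec (p *ₚ q) ρ = begin
      P * Q - P′ * Q′                   ≈⟨ -‿*-leibniz P Q P′ Q′ ⟩
      (P - P′) * Q +ᴿ P′ * (Q - Q′)     ≈⟨ +-cong (*-congʳ (∂-spec p ρ)) (*-congˡ (∂-spec q ρ)) ⟩
      (d * ∂P) * Q +ᴿ P′ * (d * ∂Q)     ≈⟨ +-cong (*-assoc d ∂P Q) (x∙yz≈y∙xz P′ d ∂Q) ⟩
      d * (∂P * Q) +ᴿ d * (P′ * ∂Q)     ≈⟨ ≈-sym (distribˡ d _ _) ⟩
      d * (∂P * Q +ᴿ P′ * ∂Q)           ≈⟨ *-congˡ (+-congˡ (*-congʳ (reflexive (sym (swapVars-⟦⟧ p ρ))))) ⟩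
      d * (∂P * Q +ᴿ ⟦ R ⟧ (swapVars p) ρ * ∂Q) ∎
      where
      P Q P′ Q′ ∂P ∂Q d : Carrier
      P = ⟦ R ⟧ p ρ ; Q = ⟦ R ⟧ q ρ ; d = ρ X - ρ Y
      P′ = ⟦ R ⟧ p (ρ ∘ swap X Y) ; Q′ = ⟦ R ⟧ q (ρ ∘ swap X Y)
      ∂P = ⟦ R ⟧ (∂ p) ρ ; ∂Q = ⟦ R ⟧ (∂ q) ρ
    ∂-spec (-ₚ p) ρ = begin
      - P - - P′               ≈⟨ -‿neg P P′ ⟩
      - (P - P′)               ≈⟨ -‿cong (∂-spec p ρ) ⟩
      - (d * ⟦ R ⟧ (∂ p) ρ)    ≈⟨ -‿distribʳ-* d _ ⟩
      d * - ⟦ R ⟧ (∂ p) ρ      ∎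
      where
      P P′ d : Carrier
      P = ⟦ R ⟧ p ρ ; P′ = ⟦ R ⟧ p (ρ ∘ swap X Y) ; d = ρ X - ρ Y

∣P-swapVars : (X Y : Fin n) (p q : Poly n) →
  (∀ (R : CommutativeRing 0ℓ 0ℓ) ρ → CommutativeRing._≈_ R (⟦ R ⟧ q ρ) (⟦ R ⟧ p (ρ ∘ swap X Y))) →
  (t X -ₚ t Y) ∣P (p -ₚ q)
∣P-swapVars X Y p q q≈p∘swap = ∂ p , λ R ρ →
  CommutativeRing.trans R (CommutativeRing.+-congˡ R (CommutativeRing.-‿cong R (q≈p∘swap R ρ))) (∂-spec R p ρ)
  where open DividedDifference X Y

module PairProduct (R : CommutativeRing 0ℓ 0ℓ) where
  open CommutativeRing R renaming (refl to ≈-refl; sym to ≈-sym; trans to ≈-trans)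
  open RingLemmas R
  open import Relation.Binary.Reasoning.Setoid setoid

  ∏ : (Fin n → Carrier) → List (Pair n) → Carrier
  ∏ ρ [] = 1#
  ∏ ρ ((a , b) ∷ L) = (ρ a - ρ b) * ∏ ρ L

  ⟦foldr⟧≈∏ : (y : Fin n → Fin n) (F : Pair n → Poly n → Poly n) →
    (∀ a b rest → F (a , b) rest ≡ (t (y a) -ₚ t (y b)) *ₚ rest) →
    ∀ L ρ → ⟦ R ⟧ (foldr F (con (+ 1)) L) ρ ≈ ∏ (ρ ∘ y) L
  ⟦foldr⟧≈∏ y F F-def [] ρ = ℤ→R-1
  ⟦foldr⟧≈∏ y F F-def ((a , b) ∷ L) ρ =
    ≈-trans (reflexive (cong (λ u → ⟦ R ⟧ u ρ) (F-def a b _))) (*-congˡ (⟦foldr⟧≈∏ y F F-def L ρ))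

  ∏-cong : {ρ₁ ρ₂ : Fin n → Carrier} → (∀ x → ρ₁ x ≡ ρ₂ x) → ∀ L → ∏ ρ₁ L ≡ ∏ ρ₂ L
  ∏-cong ρ₁≗ρ₂ [] = refl
  ∏-cong ρ₁≗ρ₂ ((a , b) ∷ L) = cong₂ _*_ (cong₂ _-_ (ρ₁≗ρ₂ a) (ρ₁≗ρ₂ b)) (∏-cong ρ₁≗ρ₂ L)

  ∏-↭ : (ρ : Fin n → Carrier) {L L′ : List (Pair n)} → L ↭ L′ → ∏ ρ L ≈ ∏ ρ L′
  ∏-↭ ρ ↭.refl = ≈-refl
  ∏-↭ ρ (↭.prep (a , b) L↭L′) = *-congˡ (∏-↭ ρ L↭L′)
  ∏-↭ ρ (↭.swap {xs} {ys} (a , b) (c , d) L↭L′) = begin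
    A * (B * ∏ ρ xs)  ≈⟨ ≈-sym (*-assoc A B _) ⟩
    (A * B) * ∏ ρ xs  ≈⟨ *-cong (*-comm A B) (∏-↭ ρ L↭L′) ⟩
    (B * A) * ∏ ρ ys  ≈⟨ *-assoc B A _ ⟩
    B * (A * ∏ ρ ys)  ∎
    where
    A B : Carrier
    A = ρ a - ρ b ; B = ρ c - ρ d
  ∏-↭ ρ (↭.trans L↭L′ L′↭L″) = ≈-trans (∏-↭ ρ L↭L′) (∏-↭ ρ L′↭L″)

  ∏-map : (ρ : Fin n → Carrier) (σ : Fin n → Fin n) (L : List (Pair n)) → ∏ ρ (map (pairMap σ) L) ≡ ∏ (ρ ∘ σ) L
  ∏-map ρ σ [] = refl
  ∏-map ρ σ ((a , b) ∷ L) = cong ((ρ (σ a) - ρ (σ b)) *_) (∏-map ρ σ L)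

  ∏-extract : (ρ : Fin n → Carrier) (as : List (Pair n)) (a b : Fin n) (bs : List (Pair n)) →
    ∏ ρ (as ++ (a , b) ∷ bs) ≈ (ρ a - ρ b) * ∏ ρ (as ++ bs)
  ∏-extract ρ as a b bs = ∏-↭ ρ (shift (a , b) as bs)

  ∏-scale : (ρ : Fin n → Carrier) (c : Carrier) (L : List (Pair n)) →
    ∏ (λ x → c * ρ x) L ≈ powR R c (length L) * ∏ ρ L
  ∏-scale ρ c [] = ≈-sym (*-identityʳ 1#)
  ∏-scale ρ c ((a , b) ∷ L) = begin
    (c * ρ a - c * ρ b) * ∏ (λ x → c * ρ x) L           ≈⟨ *-cong (≈-sym (x[y-z]≈xy-xz c (ρ a) (ρ b))) (∏-scale ρ c L) ⟩
    (c * (ρ a - ρ b)) * (powR R c (length L) * ∏ ρ L)   ≈⟨ interchange c (ρ a - ρ b) (powR R c (length L)) (∏ ρ L) ⟩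
    (c * powR R c (length L)) * ((ρ a - ρ b) * ∏ ρ L)   ∎
    where
    open import Algebra.Properties.Ring ring using (x[y-z]≈xy-xz)
    open import Algebra.Properties.CommutativeSemigroup *-commutativeSemigroup using (interchange)

-- The class f_λ^(k)

module Class {n : ℕ} (h : Fin n → Fin n) (λ₁ λ₂ k : ℕ) (1≤λ₁ : 1 ≤ λ₁) (λ-sum : λ₁ + λ₂ ≡ n)
  (k≤λ₂ : k ≤ λ₂) (vk : Perm n) (vk-isVk : IsVk λ₁ λ₂ k vk) where

  λ₁≤n : λ₁ ≤ n
  λ₁≤n = subst (λ₁ ≤_) λ-sum (m≤m+n λ₁ λ₂)

  Above : (Fin n → Fin n) → Set
  Above = AboveVk λ₁ λ₂ k

  above? : (u : Fin n → Fin n) → Dec (Above u)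
  above? u = all? (λ x → (toℕ x <? k) →-dec (λ₁ ≤? toℕ (u x)))
       ×-dec all? (λ x → (λ₂ <? toℕ x) →-dec (toℕ (u x) <? λ₁))

  vk-above : Above (vk ⟨$⟩ʳ_)
  vk-above =
    (λ x x<k → subst (λ₁ ≤_) (sym (trans (vk-isVk x) (vkFun-before λ₁ λ₂ k x<k))) (m≤m+n λ₁ (toℕ x))) ,
    (λ x λ₂<x → subst (_< λ₁) (sym (trans (vk-isVk x) (vkFun-after λ₁ λ₂ k k≤λ₂ λ₂<x)))
       (vkFun-after-< 1≤λ₁ (subst (toℕ x <_) (sym λ-sum) (toℕ<n x))))

  ≤B⇒above : (v : Perm n) → vk ≤B v → Above (v ⟨$⟩ʳ_)
  ≤B⇒above v vk≤v = ≤B-AboveVk vk≤v vk-above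

  above⇒≤B : (v : Perm n) → InλSn λ₁ v → Above (v ⟨$⟩ʳ_) → vk ≤B v
  above⇒≤B v v-grass v-above with Grassmannian-AboveVk⇒IsVk λ₁ λ₂ k 1≤λ₁ λ-sum k≤λ₂ v v-grass v-above
  ... | a , k≤a , a≤λ₂ , v-isVk = VkChain.IsVk-≤B λ₁ λ₂ 1≤λ₁ λ-sum vk-isVk k≤a a≤λ₂ v-isVk

  module Factor (w : Perm n) = Factorization λ₁ w

  fₖ : Perm n → Poly n
  fₖ w with above? (Factor.v w ⟨$⟩ʳ_)
  ... | yes _ = prodSk h vk (Factor.y w)
  ... | no _ = con (+ 0)

  fₖ-above : (w : Perm n) → Above (Factor.v w ⟨$⟩ʳ_) → fₖ w ≡ prodSk h vk (Factor.y w)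
  fₖ-above w above with above? (Factor.v w ⟨$⟩ʳ_)
  ... | yes _ = refl
  ... | no not-above = ⊥-elim (not-above above)

  fₖ-not-above : (w : Perm n) → ¬ Above (Factor.v w ⟨$⟩ʳ_) → fₖ w ≡ con (+ 0)
  fₖ-not-above w not-above with above? (Factor.v w ⟨$⟩ʳ_)
  ... | yes above = ⊥-elim (not-above above)
  ... | no _ = refl

  Sₖ : List (Pair n)
  Sₖ = Sk h vk

  prodSk-⟦⟧ : (y : Perm n) (R : CommutativeRing 0ℓ 0ℓ) (ρ : Fin n → CommutativeRing.Carrier R) →
    CommutativeRing._≈_ R (⟦ R ⟧ (prodSk h vk y) ρ) (PairProduct.∏ R (ρ ∘ (y ⟨$⟩ʳ_)) Sₖ)
  prodSk-⟦⟧ y R ρ = PairProduct.⟦foldr⟧≈∏ R (y ⟨$⟩ʳ_) _ (λ _ _ _ → refl) Sₖ ρ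

  prodSk-cong : (y y′ : Perm n) → y ≈ₚ y′ → prodSk h vk y ≈P prodSk h vk y′
  prodSk-cong y y′ y≈y′ R ρ = trans≈ (prodSk-⟦⟧ y R ρ)
    (trans≈ (reflexive (PairProduct.∏-cong R (cong ρ ∘ y≈y′) Sₖ)) (sym≈ (prodSk-⟦⟧ y′ R ρ)))
    where open CommutativeRing R using (reflexive) renaming (trans to trans≈; sym to sym≈)

  prodSk-homogeneous : (y : Perm n) → Homogeneous (length Sₖ) (prodSk h vk y)
  prodSk-homogeneous y R ρ c = trans≈ (prodSk-⟦⟧ y R _)
    (trans≈ (PairProduct.∏-scale R (ρ ∘ (y ⟨$⟩ʳ_)) c Sₖ) (*-congˡ (sym≈ (prodSk-⟦⟧ y R ρ))))
    where open CommutativeRing R using (*-congˡ) renaming (trans to trans≈; sym to sym≈)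

  fₖ-IsFk : IsFk λ₁ h vk fₖ
  fₖ-IsFk w y′ v′ y′∈Sλ v′-grass w≈y′v′ = when-≤B , when-≰B
    where
    open Factor w
    open FactorizationUnique λ₁ λ₁≤n v v′ v∈λSn v′-grass (y ⟨$⟩ʳ_) (y′ ⟨$⟩ʳ_)
      y-PreservesBlocks (Sλ-PreservesBlocks y′ y′∈Sλ) (λ x → trans (sym (w≈yv x)) (w≈y′v′ x))
    when-≤B : vk ≤B v′ → fₖ w ≈P prodSk h vk y′
    when-≤B vk≤v′ = ≈P-trans {p = fₖ w} {q = prodSk h vk y} {r = prodSk h vk y′}
      (≈P-reflexive (fₖ-above w (AboveVk-resp (sym ∘ v₁≈v₂) (≤B⇒above v′ vk≤v′))))
      (prodSk-cong y y′ y₁≗y₂)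
    when-≰B : ¬ (vk ≤B v′) → fₖ w ≈P con (+ 0)
    when-≰B vk≰v′ = ≈P-reflexive (fₖ-not-above w λ above → vk≰v′ (≤B-respʳ (above⇒≤B v v∈λSn above) v₁≈v₂))

  IsFk⇒≈fₖ : (f : Perm n → Poly n) → IsFk λ₁ h vk f → ∀ w → f w ≈P fₖ w
  IsFk⇒≈fₖ f f-isFk w = by-cases (above? (v ⟨$⟩ʳ_))
    where
    open Factor w
    by-cases : Dec (Above (v ⟨$⟩ʳ_)) → f w ≈P fₖ w
    by-cases (yes above) = ≈P-trans {p = f w} {q = prodSk h vk y} {r = fₖ w}
      (proj₁ (f-isFk w y v y∈Sλ v∈λSn w≈yv) (above⇒≤B v v∈λSn above))
      (≈P-reflexive (sym (fₖ-above w above)))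
    by-cases (no not-above) = ≈P-trans {p = f w} {q = con (+ 0)} {r = fₖ w}
      (proj₂ (f-isFk w y v y∈Sλ v∈λSn w≈yv) (not-above ∘ ≤B⇒above v))
      (≈P-reflexive (sym (fₖ-not-above w not-above)))

  fₖ-homogeneous : (w : Perm n) → Homogeneous (length Sₖ) (fₖ w)
  fₖ-homogeneous w with above? (Factor.v w ⟨$⟩ʳ_)
  ... | yes _ = prodSk-homogeneous (Factor.y w)
  ... | no _ = Homogeneous-0 (length Sₖ)

-- The GKM conditions

toℕ≤n∸1 : ∀ {n} (x : Fin n) → toℕ x ≤ n ∸ 1
toℕ≤n∸1 {suc n} x = toℕ≤pred[n] x

module GKMConditions {n : ℕ} (h : Fin n → Fin n) (h-mono : ∀ i j → toℕ i ≤ toℕ j → toℕ (h i) ≤ toℕ (h j))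
  (λ₁ λ₂ k : ℕ) (1≤λ₁ : 1 ≤ λ₁) (λ-sum : λ₁ + λ₂ ≡ n) (k≤λ₂ : k ≤ λ₂)
  (h-last : 1 < λ₁ → (i : Fin n) → toℕ i ≡ suc k → toℕ (h i) ≡ n ∸ 1)
  (vk : Perm n) (vk-isVk : IsVk λ₁ λ₂ k vk) where

  open Class h λ₁ λ₂ k 1≤λ₁ λ-sum k≤λ₂ vk vk-isVk

  after-small : ∀ {p} → p < n → p ∸ λ₂ < λ₁
  after-small {p} p<n = vkFun-after-< 1≤λ₁ (subst (p <_) (sym λ-sum) p<n)

  middle-large : ∀ {m p} → m < p → λ₁ + p ∸ 1 ≡ λ₁ + (p ∸ 1)
  middle-large m<p = +-∸-assoc λ₁ (≤-trans (s≤s z≤n) m<p)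

  h-top : 1 < λ₁ → ∀ (q : Fin n) → suc k ≤ toℕ q → n ∸ 1 ≤ toℕ (h q)
  h-top 1<λ₁ q 1+k≤q = subst (_≤ toℕ (h q)) (h-last 1<λ₁ k+1 (toℕ-fromℕ< k+1<n))
                             (h-mono k+1 q (subst (_≤ toℕ q) (sym (toℕ-fromℕ< k+1<n)) 1+k≤q))
    where
    k+1<n : suc k < n
    k+1<n = <-≤-trans (s≤s 1+k≤q) (toℕ<n q)
    k+1 : Fin n
    k+1 = fromℕ< k+1<n

  vk⁻¹ : Fin n → Fin n
  vk⁻¹ b = vk ⟨$⟩ˡ b

  vkFun-vk⁻¹ : ∀ b → vkFun λ₁ λ₂ k (toℕ (vk⁻¹ b)) ≡ toℕ b
  vkFun-vk⁻¹ b = trans (sym (vk-isVk (vk⁻¹ b))) (cong toℕ (inverseʳ vk))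

  vk⁻¹-unique : ∀ p b → vkFun λ₁ λ₂ k (toℕ p) ≡ toℕ b → vk⁻¹ b ≡ p
  vk⁻¹-unique p b e = trans (cong vk⁻¹ (toℕ-injective (sym (trans (vk-isVk p) e)))) (inverseˡ vk)

  vk⁻¹-large : ∀ b → λ₁ + k ≤ toℕ b → k < toℕ (vk⁻¹ b) × toℕ (vk⁻¹ b) ≤ λ₂
  vk⁻¹-large b λ₁+k≤b with vkFunView λ₁ λ₂ k (toℕ (vk⁻¹ b)) k≤λ₂
  ... | before p<k e = ⊥-elim (<⇒≱ (+-monoʳ-< λ₁ p<k) (subst (λ₁ + k ≤_) (trans (sym (vkFun-vk⁻¹ b)) e) λ₁+k≤b))
  ... | at _ e = ⊥-elim (<⇒≱ (≤-trans 1≤λ₁ (m≤m+n λ₁ k)) (subst (λ₁ + k ≤_) (trans (sym (vkFun-vk⁻¹ b)) e) λ₁+k≤b))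
  ... | middle k<p p≤λ₂ _ = k<p , p≤λ₂
  ... | after _ e = ⊥-elim (<⇒≱ (after-small (toℕ<n (vk⁻¹ b)))
          (≤-trans (m≤m+n λ₁ k) (subst (λ₁ + k ≤_) (trans (sym (vkFun-vk⁻¹ b)) e) λ₁+k≤b)))

  ∈Sₖ : ∀ {a b} → toℕ a < toℕ b → toℕ (vk⁻¹ b) < toℕ (vk⁻¹ a) → toℕ (vk⁻¹ a) ≤ toℕ (h (vk⁻¹ b)) → (a , b) ∈ Sₖ
  ∈Sₖ a<b descent hess = ∈-filter⁺ (inSk? h vk) (∈-allPairs _) (a<b , descent , hess)

  InTail : Fin n → Set
  InTail a = λ₂ < toℕ (vk⁻¹ a)

  tail-value : ∀ {a} → InTail a → toℕ a ≡ toℕ (vk⁻¹ a) ∸ λ₂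
  tail-value {a} λ₂<Pa = trans (sym (vkFun-vk⁻¹ a)) (vkFun-after λ₁ λ₂ k k≤λ₂ λ₂<Pa)

  tail-small : ∀ {a} → InTail a → 1 < λ₁ × toℕ a < λ₁
  tail-small {a} λ₂<Pa = ≤-<-trans 1≤a a<λ₁ , a<λ₁
    where
    a<λ₁ : toℕ a < λ₁
    a<λ₁ = subst (_< λ₁) (sym (tail-value λ₂<Pa)) (after-small (toℕ<n (vk⁻¹ a)))
    1≤a : 1 ≤ toℕ a
    1≤a = subst (1 ≤_) (sym (tail-value λ₂<Pa)) (m<n⇒0<n∸m λ₂<Pa)

  Sₖ-large-end : ∀ {a b} → (a , b) ∈ Sₖ → λ₁ + k ≤ toℕ b → InTail a
  Sₖ-large-end {a} {b} ab∈Sₖ λ₁+k≤b with proj₂ (∈-filter⁻ (inSk? h vk) {xs = allPairs} ab∈Sₖ)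
  ... | a<b , descent , _ with vk⁻¹-large b λ₁+k≤b
  ...   | k<Pb , Pb≤λ₂ with vkFunView λ₁ λ₂ k (toℕ (vk⁻¹ a)) k≤λ₂
  ...     | before Pa<k _ = ⊥-elim (<-asym Pa<k (<-trans k<Pb descent))
  ...     | at Pa≡k _ = ⊥-elim (<-irrefl (sym Pa≡k) (<-trans k<Pb descent))
  ...     | after λ₂<Pa _ = λ₂<Pa
  ...     | middle k<Pa _ e = ⊥-elim (<-asym a<b (subst₂ _<_ vk[Pb]≡b vk[Pa]≡a
              (subst₂ _<_ (sym (middle-large k<Pb)) (sym (middle-large k<Pa))
                 (+-monoʳ-< λ₁ (∸-monoˡ-< descent (≤-trans (s≤s z≤n) k<Pb))))))
    where
    vk[Pa]≡a : λ₁ + toℕ (vk⁻¹ a) ∸ 1 ≡ toℕ a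
    vk[Pa]≡a = trans (sym e) (vkFun-vk⁻¹ a)
    vk[Pb]≡b : λ₁ + toℕ (vk⁻¹ b) ∸ 1 ≡ toℕ b
    vk[Pb]≡b = trans (sym (vkFun-middle λ₁ λ₂ k k<Pb Pb≤λ₂)) (vkFun-vk⁻¹ b)

  Sₖ-tail-pair : ∀ {a c} → InTail a → λ₁ + k ≤ toℕ c → (a , c) ∈ Sₖ
  Sₖ-tail-pair {a} {c} a-tail λ₁+k≤c = ∈Sₖ
    (<-≤-trans (proj₂ (tail-small a-tail)) (≤-trans (m≤m+n λ₁ k) λ₁+k≤c))
    (≤-<-trans (proj₂ (vk⁻¹-large c λ₁+k≤c)) a-tail)
    (≤-trans (toℕ≤n∸1 (vk⁻¹ a)) (h-top (proj₁ (tail-small a-tail)) (vk⁻¹ c) (proj₁ (vk⁻¹-large c λ₁+k≤c))))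

  FixesBelow : Perm n → Set
  FixesBelow σ = ∀ s → toℕ s < λ₁ + k → σ ⟨$⟩ʳ s ≡ s

  FixesBelow-inverse : ∀ {σ} → FixesBelow σ → FixesBelow (flip σ)
  FixesBelow-inverse {σ} σ-fix s s< = trans (cong (σ ⟨$⟩ˡ_) (sym (σ-fix s s<))) (inverseˡ σ)

  Sₖ-closed : ∀ {σ} → FixesBelow σ → ∀ {e} → e ∈ Sₖ → pairMap (σ ⟨$⟩ʳ_) e ∈ Sₖ
  Sₖ-closed {σ} σ-fix {a , b} ab∈Sₖ with toℕ b <? λ₁ + k
  ... | yes b< = subst (_∈ Sₖ) (sym (cong₂ _,_ (σ-fix a (<-trans a<b b<)) (σ-fix b b<))) ab∈Sₖ
    where
    a<b : toℕ a < toℕ b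
    a<b = proj₁ (proj₂ (∈-filter⁻ (inSk? h vk) {xs = allPairs} ab∈Sₖ))
  ... | no b≮ = subst (λ z → (z , σ ⟨$⟩ʳ b) ∈ Sₖ) (sym σa≡a) (Sₖ-tail-pair a-tail λ₁+k≤σb)
    where
    a-tail : InTail a
    a-tail = Sₖ-large-end ab∈Sₖ (≮⇒≥ b≮)
    σa≡a : σ ⟨$⟩ʳ a ≡ a
    σa≡a = σ-fix a (<-≤-trans (proj₂ (tail-small a-tail)) (m≤m+n λ₁ k))
    λ₁+k≤σb : λ₁ + k ≤ toℕ (σ ⟨$⟩ʳ b)
    λ₁+k≤σb = ≮⇒≥ λ σb< → b≮ (subst (λ z → toℕ z < λ₁ + k) (permute-injective σ (σ-fix _ σb<)) σb<)

  Sₖ-↭ : ∀ {σ} → FixesBelow σ → map (pairMap (σ ⟨$⟩ʳ_)) Sₖ ↭ Sₖ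
  Sₖ-↭ {σ} σ-fix = ∼bag⇒↭ (unique∧set⇒bag {xs = map (pairMap (σ ⟨$⟩ʳ_)) Sₖ}
    (Unique.map⁺ {f = pairMap (σ ⟨$⟩ʳ_)} pairMap-injective Sₖ-unique) Sₖ-unique (mk⇔ image⊆Sₖ Sₖ⊆image))
    where
    Sₖ-unique : Unique Sₖ
    Sₖ-unique = Unique.filter⁺ (inSk? h vk) allPairs-unique
    pairMap-injective : ∀ {x y} → pairMap (σ ⟨$⟩ʳ_) x ≡ pairMap (σ ⟨$⟩ʳ_) y → x ≡ y
    pairMap-injective {_ , _} {_ , _} e = cong₂ _,_ (permute-injective σ (cong proj₁ e)) (permute-injective σ (cong proj₂ e))
    image⊆Sₖ : ∀ {z} → z ∈ map (pairMap (σ ⟨$⟩ʳ_)) Sₖ → z ∈ Sₖ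
    image⊆Sₖ z∈ with ∈-map⁻ (pairMap (σ ⟨$⟩ʳ_)) z∈
    ... | e , e∈ , refl = Sₖ-closed {σ} σ-fix e∈
    Sₖ⊆image : ∀ {z} → z ∈ Sₖ → z ∈ map (pairMap (σ ⟨$⟩ʳ_)) Sₖ
    Sₖ⊆image {a , b} z∈ = subst (_∈ map (pairMap (σ ⟨$⟩ʳ_)) Sₖ) (cong₂ _,_ (inverseʳ σ) (inverseʳ σ))
      (∈-map⁺ (pairMap (σ ⟨$⟩ʳ_)) (Sₖ-closed {flip σ} (FixesBelow-inverse {σ} σ-fix) z∈))

  ∏-Sₖ-invariant : ∀ {σ} → FixesBelow σ → (R : CommutativeRing 0ℓ 0ℓ) (ρ : Fin n → CommutativeRing.Carrier R) →
    CommutativeRing._≈_ R (PairProduct.∏ R (ρ ∘ (σ ⟨$⟩ʳ_)) Sₖ) (PairProduct.∏ R ρ Sₖ)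
  ∏-Sₖ-invariant {σ} σ-fix R ρ =
    CommutativeRing.trans R (CommutativeRing.reflexive R (sym (∏-map ρ (σ ⟨$⟩ʳ_) Sₖ))) (∏-↭ ρ (Sₖ-↭ {σ} σ-fix))
    where open PairProduct R

  prodSk-divisible : (y : Perm n) {c d : Fin n} → (c , d) ∈ Sₖ →
    (t (y ⟨$⟩ʳ c) -ₚ t (y ⟨$⟩ʳ d)) ∣P (prodSk h vk y -ₚ con (+ 0))
  prodSk-divisible y {c} {d} cd∈Sₖ with ∈-∃++ cd∈Sₖ
  ... | as , bs , Sₖ≡ = foldr F (con (+ 1)) (as ++ bs) , factor
    where
    F : Pair n → Poly n → Poly n
    F (a , b) rest = (t (y ⟨$⟩ʳ a) -ₚ t (y ⟨$⟩ʳ b)) *ₚ rest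
    factor : (prodSk h vk y -ₚ con (+ 0)) ≈P ((t (y ⟨$⟩ʳ c) -ₚ t (y ⟨$⟩ʳ d)) *ₚ foldr F (con (+ 1)) (as ++ bs))
    factor R ρ = begin
      ⟦ R ⟧ (prodSk h vk y) ρ - 0#        ≈⟨ +-congˡ ε⁻¹≈ε ⟩
      ⟦ R ⟧ (prodSk h vk y) ρ +ᴿ 0#       ≈⟨ +ᴿ-identityʳ _ ⟩
      ⟦ R ⟧ (prodSk h vk y) ρ             ≈⟨ prodSk-⟦⟧ y R ρ ⟩
      ∏ ρy Sₖ                             ≡⟨ cong (∏ ρy) Sₖ≡ ⟩
      ∏ ρy (as ++ (c , d) ∷ bs)           ≈⟨ ∏-extract ρy as c d bs ⟩
      (ρy c - ρy d) * ∏ ρy (as ++ bs)     ≈⟨ *-congˡ (≈-sym (⟦foldr⟧≈∏ (y ⟨$⟩ʳ_) F (λ _ _ _ → refl) (as ++ bs) ρ)) ⟩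
      (ρy c - ρy d) * ⟦ R ⟧ (foldr F (con (+ 1)) (as ++ bs)) ρ ∎
      where
      open CommutativeRing R using (Carrier; _-_; _*_; 0#; +-congˡ; *-congˡ; setoid; +-group)
        renaming (sym to ≈-sym; _+_ to _+ᴿ_; +-identityʳ to +ᴿ-identityʳ)
      open PairProduct R
      open import Algebra.Properties.Group +-group using (ε⁻¹≈ε)
      open import Relation.Binary.Reasoning.Setoid setoid
      ρy : Fin n → Carrier
      ρy = ρ ∘ (y ⟨$⟩ʳ_)

  Grassmannian-small⇒IsVk : (u : Perm n) → InλSn λ₁ u → Above (u ⟨$⟩ʳ_) →
    (x : Fin n) → toℕ x ≤ λ₂ → toℕ (u ⟨$⟩ʳ x) < λ₁ → IsVk λ₁ λ₂ (toℕ x) u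
  Grassmannian-small⇒IsVk u u-grass u-above x x≤λ₂ ux<λ₁
    with Grassmannian-AboveVk⇒IsVk λ₁ λ₂ k 1≤λ₁ λ-sum k≤λ₂ u u-grass u-above
  ... | a , _ , a≤λ₂ , u-isVk with vkFun-small⇒at λ₁ λ₂ a a≤λ₂ x≤λ₂ (subst (_< λ₁) (u-isVk x) ux<λ₁)
  ...   | refl = u-isVk

  module Edge (w : Perm n) (i j : Fin n) (j<i : toℕ j < toℕ i) (i≤hj : toℕ i ≤ toℕ (h j))
              (wi<wj : toℕ (w ⟨$⟩ʳ i) < toℕ (w ⟨$⟩ʳ j)) where

    w′ : Perm n
    w′ = w · transpose i j

    open Factor w
    open Factor w′ using () renaming
      (y to y′; v to v′; v∈λSn to v′∈λSn; w≈yv to w′≈y′v′; y-PreservesBlocks to y′-PreservesBlocks)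

    Divisor : Poly n
    Divisor = t (w ⟨$⟩ʳ i) -ₚ t (w ⟨$⟩ʳ j)

    Goal : Set₁
    Goal = Divisor ∣P (fₖ w -ₚ fₖ w′)

    goal-via : (p p′ : Poly n) → fₖ w ≡ p → fₖ w′ ≡ p′ → Divisor ∣P (p -ₚ p′) → Goal
    goal-via p p′ fₖw≡p fₖw′≡p′ = ∣P-resp {a = fₖ w} {fₖ w′} {p} {p′} {Divisor} (≈P-reflexive fₖw≡p) (≈P-reflexive fₖw′≡p′)

    both-not-above : ¬ Above (v ⟨$⟩ʳ_) → ¬ Above (v′ ⟨$⟩ʳ_) → Goal
    both-not-above not-above not-above′ =
      goal-via _ _ (fₖ-not-above w not-above) (fₖ-not-above w′ not-above′) (∣P-0-0 {d = Divisor})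

    -- Here w′ = (y (v i v j)) v is the factorization of w′, so f(w′) is f(w) with
    -- t_{w i} and t_{w j} swapped.
    module SameBlock (vi⇒vj : toℕ (v ⟨$⟩ʳ i) < λ₁ → toℕ (v ⟨$⟩ʳ j) < λ₁)
                     (vj⇒vi : toℕ (v ⟨$⟩ʳ j) < λ₁ → toℕ (v ⟨$⟩ʳ i) < λ₁) where

      c d : Fin n
      c = v ⟨$⟩ʳ i
      d = v ⟨$⟩ʳ j

      yτv≗y′v′ : ∀ x → y ⟨$⟩ʳ swap c d (v ⟨$⟩ʳ x) ≡ y′ ⟨$⟩ʳ (v′ ⟨$⟩ʳ x)
      yτv≗y′v′ x = trans (cong (y ⟨$⟩ʳ_) (sym (swap-conjugate v i j x))) (trans (sym (w≈yv (swap i j x))) (w′≈y′v′ x))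

      open FactorizationUnique λ₁ λ₁≤n v v′ v∈λSn v′∈λSn ((y ⟨$⟩ʳ_) ∘ swap c d) (y′ ⟨$⟩ʳ_)
        (PreservesBlocks-∘ y-PreservesBlocks (swap-PreservesBlocks c d vi⇒vj vj⇒vi)) y′-PreservesBlocks yτv≗y′v′

      prodSk-y′ : ∀ (R : CommutativeRing 0ℓ 0ℓ) ρ → CommutativeRing._≈_ R
        (⟦ R ⟧ (prodSk h vk y′) ρ) (⟦ R ⟧ (prodSk h vk y) (ρ ∘ swap (y ⟨$⟩ʳ c) (y ⟨$⟩ʳ d)))
      prodSk-y′ R ρ = begin
        ⟦ R ⟧ (prodSk h vk y′) ρ                        ≈⟨ prodSk-⟦⟧ y′ R ρ ⟩
        ∏ (ρ ∘ (y′ ⟨$⟩ʳ_)) Sₖ                           ≡⟨ ∏-cong (λ s → cong ρ (trans (sym (y₁≗y₂ s)) (swap-conjugate y c d s))) Sₖ ⟩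
        ∏ (ρ ∘ swap (y ⟨$⟩ʳ c) (y ⟨$⟩ʳ d) ∘ (y ⟨$⟩ʳ_)) Sₖ ≈⟨ sym≈ (prodSk-⟦⟧ y R _) ⟩
        ⟦ R ⟧ (prodSk h vk y) (ρ ∘ swap (y ⟨$⟩ʳ c) (y ⟨$⟩ʳ d)) ∎
        where
        open CommutativeRing R using (setoid) renaming (sym to sym≈)
        open PairProduct R
        open import Relation.Binary.Reasoning.Setoid setoid

      goal : Goal
      goal = by-cases (above? (v ⟨$⟩ʳ_))
        where
        by-cases : Dec (Above (v ⟨$⟩ʳ_)) → Goal
        by-cases (no not-above) = both-not-above not-above (not-above ∘ AboveVk-resp (sym ∘ v₁≈v₂))
        by-cases (yes above) = goal-via _ _ (fₖ-above w above) (fₖ-above w′ (AboveVk-resp v₁≈v₂ above))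
          (subst₂ (λ X Y → (t X -ₚ t Y) ∣P (prodSk h vk y -ₚ prodSk h vk y′)) (sym (w≈yv i)) (sym (w≈yv j))
            (∣P-swapVars (y ⟨$⟩ʳ c) (y ⟨$⟩ʳ d) (prodSk h vk y) (prodSk h vk y′) prodSk-y′))

    above-w⇒v : Above (w ⟨$⟩ʳ_) → Above (v ⟨$⟩ʳ_)
    above-w⇒v = AboveVk-blockwise⁻ y-PreservesBlocks w≈yv

    above-v⇒w : Above (v ⟨$⟩ʳ_) → Above (w ⟨$⟩ʳ_)
    above-v⇒w = AboveVk-blockwise y-PreservesBlocks w≈yv

    above-w′⇒v′ : Above (w′ ⟨$⟩ʳ_) → Above (v′ ⟨$⟩ʳ_)
    above-w′⇒v′ = AboveVk-blockwise⁻ y′-PreservesBlocks w′≈y′v′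

    above-v′⇒w′ : Above (v′ ⟨$⟩ʳ_) → Above (w′ ⟨$⟩ʳ_)
    above-v′⇒w′ = AboveVk-blockwise y′-PreservesBlocks w′≈y′v′

    module CrossBlock (wi<λ₁ : toℕ (w ⟨$⟩ʳ i) < λ₁) (λ₁≤wj : λ₁ ≤ toℕ (w ⟨$⟩ʳ j)) where

      w′i≡wj : w′ ⟨$⟩ʳ i ≡ w ⟨$⟩ʳ j
      w′i≡wj = cong (w ⟨$⟩ʳ_) (swap-left i j)

      w′j≡wi : w′ ⟨$⟩ʳ j ≡ w ⟨$⟩ʳ i
      w′j≡wi = cong (w ⟨$⟩ʳ_) (swap-right i j)

      -- v_k ≤ w′ forces i, j into the window [k, λ₂] (0-indexed) where w and w′ may differ
      above-w′⇒window : Above (w′ ⟨$⟩ʳ_) → k ≤ toℕ j × toℕ i ≤ λ₂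
      above-w′⇒window (big , small) =
        ≮⇒≥ (λ j<k → <⇒≱ (subst (λ z → toℕ z < λ₁) (sym w′j≡wi) wi<λ₁) (big j j<k)) ,
        ≮⇒≥ (λ λ₂<i → <⇒≱ (small i λ₂<i) (subst (λ z → λ₁ ≤ toℕ z) (sym w′i≡wj) λ₁≤wj))

      w′≡w-outside : k ≤ toℕ j → toℕ i ≤ λ₂ → ∀ x → (toℕ x < k ⊎ λ₂ < toℕ x) → w′ ⟨$⟩ʳ x ≡ w ⟨$⟩ʳ x
      w′≡w-outside k≤j i≤λ₂ x outside = cong (w ⟨$⟩ʳ_) (swap-other i j (x≢i outside) (x≢j outside))
        where
        x≢i : ∀ {x} → (toℕ x < k ⊎ λ₂ < toℕ x) → x ≢ i
        x≢i (inj₁ i<k) refl = <-irrefl refl (<-≤-trans i<k (≤-trans k≤j (<⇒≤ j<i)))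
        x≢i (inj₂ λ₂<i) refl = <-irrefl refl (<-≤-trans λ₂<i i≤λ₂)
        x≢j : ∀ {x} → (toℕ x < k ⊎ λ₂ < toℕ x) → x ≢ j
        x≢j (inj₁ j<k) refl = <-irrefl refl (<-≤-trans j<k k≤j)
        x≢j (inj₂ λ₂<j) refl = <-irrefl refl (<-≤-trans λ₂<j (≤-trans (<⇒≤ j<i) i≤λ₂))

      above-w′⇒w : Above (w′ ⟨$⟩ʳ_) → Above (w ⟨$⟩ʳ_)
      above-w′⇒w above′@(big , small) with above-w′⇒window above′
      ... | k≤j , i≤λ₂ =
        (λ x x<k → subst (λ z → λ₁ ≤ toℕ z) (w′≡w-outside k≤j i≤λ₂ x (inj₁ x<k)) (big x x<k)) ,
        (λ x λ₂<x → subst (λ z → toℕ z < λ₁) (w′≡w-outside k≤j i≤λ₂ x (inj₂ λ₂<x)) (small x λ₂<x))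

      above-w⇒w′ : Above (w ⟨$⟩ʳ_) → k ≤ toℕ j → toℕ i ≤ λ₂ → Above (w′ ⟨$⟩ʳ_)
      above-w⇒w′ (big , small) k≤j i≤λ₂ =
        (λ x x<k → subst (λ z → λ₁ ≤ toℕ z) (sym (w′≡w-outside k≤j i≤λ₂ x (inj₁ x<k))) (big x x<k)) ,
        (λ x λ₂<x → subst (λ z → toℕ z < λ₁) (sym (w′≡w-outside k≤j i≤λ₂ x (inj₂ λ₂<x))) (small x λ₂<x))

      vi<λ₁ : toℕ (v ⟨$⟩ʳ i) < λ₁
      vi<λ₁ = small⇐small y-PreservesBlocks w≈yv i wi<λ₁

      λ₁≤vj : λ₁ ≤ toℕ (v ⟨$⟩ʳ j)
      λ₁≤vj = ≮⇒≥ λ vj<λ₁ → <⇒≱ (small⇒small y-PreservesBlocks w≈yv j vj<λ₁) λ₁≤wj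

      -- Only v is above v_k: then (v i , v j) ∈ S_k, so t_{w i} - t_{w j} is a factor of f(w).
      module OneAbove (above : Above (v ⟨$⟩ʳ_)) (not-above′ : ¬ Above (v′ ⟨$⟩ʳ_)) where

        open GrassmannianAboveVk λ₁ λ₂ k 1≤λ₁ λ-sum k≤λ₂ v v∈λSn above using (a; k≤a; a≤λ₂; v-isVk)

        j≤λ₂ : toℕ j ≤ λ₂
        j≤λ₂ = ≮⇒≥ λ λ₂<j → <⇒≱ (proj₂ above j λ₂<j) λ₁≤vj

        pair∈Sₖ-tail : λ₂ < toℕ i → (v ⟨$⟩ʳ i , v ⟨$⟩ʳ j) ∈ Sₖ
        pair∈Sₖ-tail λ₂<i = ∈Sₖ (<-≤-trans vi<λ₁ λ₁≤vj) (subst (λ z → toℕ p < toℕ z) (sym Pi≡i) (≤-<-trans p≤λ₂ λ₂<i))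
                                 (subst (λ z → toℕ z ≤ toℕ (h p)) (sym Pi≡i) i≤hp)
          where
          vi≡i∸λ₂ : toℕ (v ⟨$⟩ʳ i) ≡ toℕ i ∸ λ₂
          vi≡i∸λ₂ = trans (v-isVk i) (vkFun-after λ₁ λ₂ a a≤λ₂ λ₂<i)
          Pi≡i : vk⁻¹ (v ⟨$⟩ʳ i) ≡ i
          Pi≡i = vk⁻¹-unique i (v ⟨$⟩ʳ i) (trans (vkFun-after λ₁ λ₂ k k≤λ₂ λ₂<i) (sym vi≡i∸λ₂))
          1<λ₁ : 1 < λ₁
          1<λ₁ = ≤-<-trans (subst (1 ≤_) (sym vi≡i∸λ₂) (m<n⇒0<n∸m λ₂<i)) vi<λ₁
          p : Fin n
          p = vk⁻¹ (v ⟨$⟩ʳ j)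
          vk[p]≡vj : vkFun λ₁ λ₂ k (toℕ p) ≡ toℕ (v ⟨$⟩ʳ j)
          vk[p]≡vj = vkFun-vk⁻¹ (v ⟨$⟩ʳ j)
          p≤λ₂ : toℕ p ≤ λ₂
          p≤λ₂ with vkFunView λ₁ λ₂ k (toℕ p) k≤λ₂
          ... | before p<k _ = <⇒≤ (<-≤-trans p<k k≤λ₂)
          ... | at p≡k _ = subst (_≤ λ₂) (sym p≡k) k≤λ₂
          ... | middle _ p≤λ₂ _ = p≤λ₂
          ... | after _ e = ⊥-elim (<⇒≱ (subst (_< λ₁) (trans (sym e) vk[p]≡vj) (after-small (toℕ<n p))) λ₁≤vj)
          i≤hp : toℕ i ≤ toℕ (h p)
          i≤hp with vkFunView λ₁ λ₂ k (toℕ p) k≤λ₂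
          ... | at _ e = ⊥-elim (<⇒≱ (subst (_< λ₁) (trans (sym e) vk[p]≡vj) 1≤λ₁) λ₁≤vj)
          ... | after λ₂<p _ = ⊥-elim (<⇒≱ λ₂<p p≤λ₂)
          ... | middle k<p _ _ = ≤-trans (toℕ≤n∸1 i) (h-top 1<λ₁ p k<p)
          ... | before p<k e = by-position-of-j (vkFunView λ₁ λ₂ a (toℕ j) a≤λ₂)
            where
            λ₁+p≡vj : λ₁ + toℕ p ≡ toℕ (v ⟨$⟩ʳ j)
            λ₁+p≡vj = trans (sym e) vk[p]≡vj
            by-position-of-j : VkFunView λ₁ λ₂ a (toℕ j) → toℕ i ≤ toℕ (h p)
            by-position-of-j (before _ e′) = subst (λ z → toℕ i ≤ toℕ (h z)) (sym p≡j) i≤hj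
              where p≡j = toℕ-injective (+-cancelˡ-≡ λ₁ _ _ (trans λ₁+p≡vj (trans (v-isVk j) e′)))
            by-position-of-j (at _ e′) = ⊥-elim (<⇒≱ (subst (_< λ₁) (sym (trans (v-isVk j) e′)) 1≤λ₁) λ₁≤vj)
            by-position-of-j (after λ₂<j _) = ⊥-elim (<⇒≱ λ₂<j j≤λ₂)
            by-position-of-j (middle a<j _ e′) = ⊥-elim (<⇒≱ p<k (≤-trans k≤a (≤-trans a≤j∸1 (≤-reflexive (sym p≡j∸1)))))
              where
              p≡j∸1 : toℕ p ≡ toℕ j ∸ 1
              p≡j∸1 = +-cancelˡ-≡ λ₁ _ _ (trans λ₁+p≡vj (trans (v-isVk j) (trans e′ (middle-large a<j))))
              a≤j∸1 : a ≤ toℕ j ∸ 1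
              a≤j∸1 = ≤-pred (subst (a <_) (sym (m+[n∸m]≡n (≤-trans (s≤s z≤n) a<j))) a<j)

        pair∈Sₖ-window : toℕ i ≤ λ₂ → (v ⟨$⟩ʳ i , v ⟨$⟩ʳ j) ∈ Sₖ
        pair∈Sₖ-window i≤λ₂ = ∈Sₖ (<-≤-trans vi<λ₁ λ₁≤vj)
          (subst₂ (λ z z′ → toℕ z < toℕ z′) (sym Pj≡j) (sym Pi≡k) (subst (toℕ j <_) (sym (toℕ-fromℕ< k<n)) j<k))
          (subst₂ (λ z z′ → toℕ z ≤ toℕ (h z′)) (sym Pi≡k) (sym Pj≡j)
             (subst (_≤ toℕ (h j)) (sym (toℕ-fromℕ< k<n)) (≤-trans k≤a (subst (_≤ toℕ (h j)) i≡a i≤hj))))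
          where
          j<k : toℕ j < k
          j<k = ≰⇒> λ k≤j → not-above′ (above-w′⇒v′ (above-w⇒w′ (above-v⇒w above) k≤j i≤λ₂))
          i≡a : toℕ i ≡ a
          i≡a = vkFun-small⇒at λ₁ λ₂ a a≤λ₂ i≤λ₂ (subst (_< λ₁) (v-isVk i) vi<λ₁)
          k<n : k < n
          k<n = ≤-<-trans k≤a (subst (_< n) i≡a (toℕ<n i))
          Pi≡k : vk⁻¹ (v ⟨$⟩ʳ i) ≡ fromℕ< k<n
          Pi≡k = vk⁻¹-unique (fromℕ< k<n) (v ⟨$⟩ʳ i) (begin
            vkFun λ₁ λ₂ k (toℕ (fromℕ< k<n)) ≡⟨ cong (vkFun λ₁ λ₂ k) (toℕ-fromℕ< k<n) ⟩
            vkFun λ₁ λ₂ k k                  ≡⟨ vkFun-at λ₁ λ₂ k ⟩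
            0                                ≡⟨ sym (vkFun-at λ₁ λ₂ a) ⟩
            vkFun λ₁ λ₂ a a                  ≡⟨ cong (vkFun λ₁ λ₂ a) (sym i≡a) ⟩
            vkFun λ₁ λ₂ a (toℕ i)            ≡⟨ sym (v-isVk i) ⟩
            toℕ (v ⟨$⟩ʳ i)                   ∎)
            where open ≡-Reasoning
          Pj≡j : vk⁻¹ (v ⟨$⟩ʳ j) ≡ j
          Pj≡j = vk⁻¹-unique j (v ⟨$⟩ʳ j)
            (trans (vkFun-before λ₁ λ₂ k j<k) (sym (trans (v-isVk j) (vkFun-before λ₁ λ₂ a (<-≤-trans j<k k≤a)))))

        pair∈Sₖ : (v ⟨$⟩ʳ i , v ⟨$⟩ʳ j) ∈ Sₖ
        pair∈Sₖ with λ₂ <? toℕ i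
        ... | yes λ₂<i = pair∈Sₖ-tail λ₂<i
        ... | no λ₂≮i = pair∈Sₖ-window (≮⇒≥ λ₂≮i)

        goal : Goal
        goal = goal-via _ _ (fₖ-above w above) (fₖ-not-above w′ not-above′)
          (subst₂ (λ X Y → (t X -ₚ t Y) ∣P (prodSk h vk y -ₚ con (+ 0))) (sym (w≈yv i)) (sym (w≈yv j))
            (prodSk-divisible y pair∈Sₖ))

      -- Both above: v = v_i, v′ = v_j, and y′ = y σ with σ fixing every value below λ₁ + k,
      -- so f(w) = f(w′).
      module BothAbove (above : Above (v ⟨$⟩ʳ_)) (above′ : Above (v′ ⟨$⟩ʳ_)) where

        k≤j : k ≤ toℕ j
        k≤j = proj₁ (above-w′⇒window (above-v′⇒w′ above′))

        i≤λ₂ : toℕ i ≤ λ₂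
        i≤λ₂ = proj₂ (above-w′⇒window (above-v′⇒w′ above′))

        j≤λ₂ : toℕ j ≤ λ₂
        j≤λ₂ = ≤-trans (<⇒≤ j<i) i≤λ₂

        v-isVk : IsVk λ₁ λ₂ (toℕ i) v
        v-isVk = Grassmannian-small⇒IsVk v v∈λSn above i i≤λ₂ vi<λ₁

        v′-isVk : IsVk λ₁ λ₂ (toℕ j) v′
        v′-isVk = Grassmannian-small⇒IsVk v′ v′∈λSn above′ j j≤λ₂
          (small⇐small y′-PreservesBlocks w′≈y′v′ j (subst (λ z → toℕ z < λ₁) (sym w′j≡wi) wi<λ₁))

        large-after-j : ∀ {p} → toℕ j < p → p ≤ λ₂ → λ₁ + k ≤ vkFun λ₁ λ₂ (toℕ j) p
        large-after-j {p} j<p p≤λ₂ = subst (λ₁ + k ≤_) (sym (trans (vkFun-middle λ₁ λ₂ (toℕ j) j<p p≤λ₂) (middle-large j<p)))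
          (+-monoʳ-≤ λ₁ (≤-trans k≤j (≤-pred (subst (toℕ j <_) (sym (m+[n∸m]≡n (≤-trans (s≤s z≤n) j<p))) j<p))))

        v∘swap≡v′ : ∀ p → toℕ (v′ ⟨$⟩ʳ p) < λ₁ + k → toℕ (v ⟨$⟩ʳ swap i j p) ≡ toℕ (v′ ⟨$⟩ʳ p)
        v∘swap≡v′ p v′p< with swapView i j p
        ... | at-left refl _ = ⊥-elim (<⇒≱ v′p< (subst (λ₁ + k ≤_) (sym (v′-isVk i)) (large-after-j j<i i≤λ₂)))
        ... | at-right _ refl e = begin
          toℕ (v ⟨$⟩ʳ swap i j j) ≡⟨ cong (λ z → toℕ (v ⟨$⟩ʳ z)) e ⟩
          toℕ (v ⟨$⟩ʳ i)          ≡⟨ trans (v-isVk i) (vkFun-at λ₁ λ₂ (toℕ i)) ⟩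
          0                       ≡⟨ sym (trans (v′-isVk j) (vkFun-at λ₁ λ₂ (toℕ j))) ⟩
          toℕ (v′ ⟨$⟩ʳ j)         ∎
          where open ≡-Reasoning
        ... | elsewhere _ p≢j e = trans (cong (λ z → toℕ (v ⟨$⟩ʳ z)) e) (by-position (vkFunView λ₁ λ₂ (toℕ j) (toℕ p) j≤λ₂))
          where
          by-position : VkFunView λ₁ λ₂ (toℕ j) (toℕ p) → toℕ (v ⟨$⟩ʳ p) ≡ toℕ (v′ ⟨$⟩ʳ p)
          by-position (before p<j e′) =
            trans (v-isVk p) (trans (vkFun-before λ₁ λ₂ (toℕ i) (<-trans p<j j<i)) (sym (trans (v′-isVk p) e′)))
          by-position (at p≡j _) = ⊥-elim (p≢j (toℕ-injective p≡j))
          by-position (middle j<p p≤λ₂ _) = ⊥-elim (<⇒≱ v′p< (subst (λ₁ + k ≤_) (sym (v′-isVk p)) (large-after-j j<p p≤λ₂)))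
          by-position (after λ₂<p e′) =
            trans (v-isVk p) (trans (vkFun-after λ₁ λ₂ (toℕ i) i≤λ₂ λ₂<p) (sym (trans (v′-isVk p) e′)))

        σ : Perm n
        σ = flip v′ ∘ₚ (transpose i j ∘ₚ v)

        σ-fixes : FixesBelow σ
        σ-fixes s s< = toℕ-injective (trans (v∘swap≡v′ (v′ ⟨$⟩ˡ s) (subst (λ z → toℕ z < λ₁ + k) (sym (inverseʳ v′)) s<))
                                             (cong toℕ (inverseʳ v′)))

        y′≗yσ : ∀ s → y′ ⟨$⟩ʳ s ≡ y ⟨$⟩ʳ (σ ⟨$⟩ʳ s)
        y′≗yσ s = trans (cong (y′ ⟨$⟩ʳ_) (sym (inverseʳ v′))) (trans (sym (w′≈y′v′ (v′ ⟨$⟩ˡ s))) (w≈yv (swap i j (v′ ⟨$⟩ˡ s))))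

        prodSk-y≈prodSk-y′ : prodSk h vk y ≈P prodSk h vk y′
        prodSk-y≈prodSk-y′ R ρ = begin
          ⟦ R ⟧ (prodSk h vk y) ρ              ≈⟨ prodSk-⟦⟧ y R ρ ⟩
          ∏ (ρ ∘ (y ⟨$⟩ʳ_)) Sₖ                 ≈⟨ sym≈ (∏-Sₖ-invariant {σ} σ-fixes R (ρ ∘ (y ⟨$⟩ʳ_))) ⟩
          ∏ (ρ ∘ (y ⟨$⟩ʳ_) ∘ (σ ⟨$⟩ʳ_)) Sₖ     ≡⟨ ∏-cong (cong ρ ∘ sym ∘ y′≗yσ) Sₖ ⟩
          ∏ (ρ ∘ (y′ ⟨$⟩ʳ_)) Sₖ                ≈⟨ sym≈ (prodSk-⟦⟧ y′ R ρ) ⟩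
          ⟦ R ⟧ (prodSk h vk y′) ρ             ∎
          where
          open CommutativeRing R using (setoid) renaming (sym to sym≈)
          open PairProduct R
          open import Relation.Binary.Reasoning.Setoid setoid

        goal : Goal
        goal = goal-via _ _ (fₖ-above w above) (fₖ-above w′ above′)
          (∣P-≈ {d = Divisor} {prodSk h vk y} {prodSk h vk y′} prodSk-y≈prodSk-y′)

      goal : Goal
      goal = by-cases (above? (v ⟨$⟩ʳ_)) (above? (v′ ⟨$⟩ʳ_))
        where
        by-cases : Dec (Above (v ⟨$⟩ʳ_)) → Dec (Above (v′ ⟨$⟩ʳ_)) → Goal
        by-cases (no not-above) _ = both-not-above not-above (not-above ∘ above-w⇒v ∘ above-w′⇒w ∘ above-v′⇒w′)
        by-cases (yes above) (no not-above′) = OneAbove.goal above not-above′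
        by-cases (yes above) (yes above′) = BothAbove.goal above above′

    goal : Goal
    goal with toℕ (w ⟨$⟩ʳ i) <? λ₁ | toℕ (w ⟨$⟩ʳ j) <? λ₁
    ... | yes wi<λ₁ | yes wj<λ₁ = SameBlock.goal (λ _ → small⇐small y-PreservesBlocks w≈yv j wj<λ₁)
                                                 (λ _ → small⇐small y-PreservesBlocks w≈yv i wi<λ₁)
    ... | yes wi<λ₁ | no wj≮λ₁ = CrossBlock.goal wi<λ₁ (≮⇒≥ wj≮λ₁)
    ... | no wi≮λ₁ | yes wj<λ₁ = ⊥-elim (wi≮λ₁ (<-trans wi<wj wj<λ₁))
    ... | no wi≮λ₁ | no wj≮λ₁ = SameBlock.goal (⊥-elim ∘ wi≮λ₁ ∘ small⇒small y-PreservesBlocks w≈yv i)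
                                               (⊥-elim ∘ wj≮λ₁ ∘ small⇒small y-PreservesBlocks w≈yv j)

  fₖ-GKM : GKM h fₖ
  fₖ-GKM w i j (j<i , i≤hj , wi<wj) = Edge.goal w i j j<i i≤hj wi<wj

theorem4p8 : (n : ℕ) → 2 ≤ n →
  (h : Fin n → Fin n) → IsHessenberg h →
  (λ₁ λ₂ : ℕ) → 1 ≤ λ₁ → 1 ≤ λ₂ → λ₁ + λ₂ ≡ n →
  (k : ℕ) → k ≤ λ₂ →
  (1 < λ₁ → (i : Fin n) → toℕ i ≡ suc k → toℕ (h i) ≡ n ∸ 1) →
  (vk : Perm n) → IsVk λ₁ λ₂ k vk →
  Σ (Perm n → Poly n) (IsFk λ₁ h vk) ×
  ((f : Perm n → Poly n) → IsFk λ₁ h vk f → InH2d h (length (Sk h vk)) f)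
theorem4p8 n _ h (h-mono , _) λ₁ λ₂ 1≤λ₁ _ λ-sum k k≤λ₂ h-last vk vk-isVk =
  (fₖ , fₖ-IsFk) ,
  λ f f-isFk → GKM-resp {f = f} {fₖ} (IsFk⇒≈fₖ f f-isFk) fₖ-GKM ,
               λ w → Homogeneous-resp {d = length Sₖ} {f w} {fₖ w} (IsFk⇒≈fₖ f f-isFk w) (fₖ-homogeneous w)
  where
  open Class h λ₁ λ₂ k 1≤λ₁ λ-sum k≤λ₂ vk vk-isVk
  open GKMConditions h h-mono λ₁ λ₂ k 1≤λ₁ λ-sum k≤λ₂ h-last vk vk-isVk using (fₖ-GKM)
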